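{- Let $G=(V,E)$ be a chordal graph on $n$ vertices, let $C_1$ and $C_2$ be two maximal cliques in $G$, and let $\varepsilon'\in(0,1)$. Then $G$ has a $(C_1,C_2,\varepsilon')$-simplification $G'=(V,E')$.
   Context: A graph is chordal if it has no induced cycle of length greater than $3$. $\Delta(G,G')=(|E\setminus E'|+|E'\setminus E|)/n^2$. A clique tree of a graph $H$ is a tree whose nodes are in one-to-one correspondence with the maximal cliques of $H$, such that for any two maximal cliques $C,C'$, every clique on the tree path between them contains $C\cap C'$. For a chordal $G$, maximal cliques $C_1,C_2$ of $G$ and $\varepsilon'\in(0,1)$, a graph $G'=(V,E')$ is a $(C_1,C_2,\varepsilon')$-simplification of $G$ if $G'$ is obtained from $G$ by deleting a subset of the edges with one endpoint in $C_1\setminus C_2$ and the other in $C_2\setminus C_1$, and: (1) $\Delta(G,G')\le\varepsilon'$; (2) the subgraph of $G'$ induced by $C_1\cup C_2$ is chordal and has a clique tree that is a path of length at most $2/\varepsilon'$ with $C_1$ and $C_2$ as its endpoints; (3) for every clique $C\subseteq C_1\cup C_2$ in $G$ there exists a maximal clique $C'$ in $G'$ with $|C\setminus C'|\le\varepsilon' n$.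
   Formalization: The parameter $\varepsilon'$ ranges only over the rational numbers in $(0,1)$. -}

module Defs where

open import Data.Nat using (ℕ; zero; suc; _<ᵇ_; _≤_; _≥_)
open import Data.Fin using (Fin; toℕ)
open import Data.Fin.Subset using (Subset; _∈_; _∉_; _⊆_; _∩_; _∪_; _─_; ∣_∣)
open import Data.Bool using (Bool; true; false; _∧_; _xor_; if_then_else_)
open import Data.List using (List; map; allFin)
open import Data.Nat.ListAction using (sum)
open import Data.Product using (Σ; _×_; _,_; ∃)
open import Data.Sum using (_⊎_)
open import Data.Integer using (+_)
open import Data.Rational using (ℚ; _/_; _*_)
import Data.Rational as ℚ
open import Relation.Binary.PropositionalEquality using (_≡_; _≢_)
open import Relation.Nullary using (¬_)
open import Function.Definitions using (Injective)
open import Function.Bundles using (_⇔_)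

record Graph (n : ℕ) : Set where
  field
    adj    : Fin n → Fin n → Bool
    sym    : ∀ u v → adj u v ≡ adj v u
    irrefl : ∀ u → adj u u ≡ false
open Graph public

ℕ→ℚ : ℕ → ℚ
ℕ→ℚ m = (+ m) / 1

IsClique : ∀ {n} → Graph n → Subset n → Set
IsClique G C = ∀ u v → u ∈ C → v ∈ C → u ≢ v → adj G u v ≡ true

-- Cliques of G contained in S (i.e. cliques of the induced subgraph G[S]).
IsCliqueIn : ∀ {n} → Graph n → Subset n → Subset n → Set
IsCliqueIn G S C = C ⊆ S × IsClique G C

IsMaximalCliqueIn : ∀ {n} → Graph n → Subset n → Subset n → Set
IsMaximalCliqueIn G S C =
  IsCliqueIn G S C × (∀ D → IsCliqueIn G S D → C ⊆ D → D ⊆ C)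

IsMaximalClique : ∀ {n} → Graph n → Subset n → Set
IsMaximalClique G C = IsClique G C × (∀ D → IsClique G D → C ⊆ D → D ⊆ C)

CycAdj : ∀ {k} → Fin k → Fin k → Set
CycAdj {k} i j =
  (toℕ j ≡ suc (toℕ i)) ⊎ (toℕ i ≡ suc (toℕ j)) ⊎
  ((toℕ i ≡ 0) × (suc (toℕ j) ≡ k)) ⊎ ((toℕ j ≡ 0) × (suc (toℕ i) ≡ k))

InducedCycleIn : ∀ {n} → Graph n → Subset n → (k : ℕ) → (Fin k → Fin n) → Set
InducedCycleIn G S k f =
  Injective _≡_ _≡_ f ×
  (∀ i → f i ∈ S) ×
  (∀ i j → (adj G (f i) (f j) ≡ true) ⇔ CycAdj i j)

ChordalOn : ∀ {n} → Graph n → Subset n → Set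
ChordalOn {n} G S = ∀ k → k ≥ 4 → (f : Fin k → Fin n) → ¬ InducedCycleIn G S k f

Chordal : ∀ {n} → Graph n → Set
Chordal {n} G = ChordalOn G (Data.Fin.Subset.⊤)

-- |E ∖ E'| + |E' ∖ E| : the number of unordered pairs {u,v} (u < v)
-- that are an edge in exactly one of G, G'.
edgeDiff : ∀ {n} → Graph n → Graph n → ℕ
edgeDiff {n} G G' =
  sum (map (λ u → sum (map (λ v →
        if (toℕ u <ᵇ toℕ v) ∧ (adj G u v xor adj G' u v) then 1 else 0)
      (allFin n))) (allFin n))

-- Δ(G,G') ≤ ε, i.e. edgeDiff G G' / n² ≤ ε, stated multiplied out by n².
ΔLe : ∀ {n} → Graph n → Graph n → ℚ → Set
ΔLe {n} G G' ε = ℕ→ℚ (edgeDiff G G') ℚ.≤ ε * ℕ→ℚ (n Data.Nat.* n)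

-- A clique tree of G[S] that is a path Q 0 — Q 1 — … — Q k:
-- its nodes are in one-to-one correspondence with the maximal cliques
-- of G[S], and for i ≤ j ≤ l, Q i ∩ Q l ⊆ Q j (on a path, the tree path
-- between Q i and Q l consists of the Q j with i ≤ j ≤ l).
IsPathCliqueTree : ∀ {n} → Graph n → Subset n → (k : ℕ) → (Fin (suc k) → Subset n) → Set
IsPathCliqueTree G S k Q =
  Injective _≡_ _≡_ Q ×
  (∀ i → IsMaximalCliqueIn G S (Q i)) ×
  (∀ C → IsMaximalCliqueIn G S C → ∃ λ i → Q i ≡ C) ×
  (∀ i j l → toℕ i ≤ toℕ j → toℕ j ≤ toℕ l → (Q i ∩ Q l) ⊆ Q j)

DeletesBetween : ∀ {n} → Graph n → Graph n → Subset n → Subset n → Set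
DeletesBetween G G' C₁ C₂ =
  (∀ u v → adj G' u v ≡ true → adj G u v ≡ true) ×
  (∀ u v → adj G u v ≡ true → adj G' u v ≡ false →
     (u ∈ (C₁ ─ C₂) × v ∈ (C₂ ─ C₁)) ⊎ (u ∈ (C₂ ─ C₁) × v ∈ (C₁ ─ C₂)))

IsSimplification : ∀ {n} → Graph n → Subset n → Subset n → ℚ → Graph n → Set
IsSimplification {n} G C₁ C₂ ε G' =
  DeletesBetween G G' C₁ C₂ ×
  ΔLe G G' ε ×
  -- (2) G'[C₁ ∪ C₂] chordal, with a path clique tree of length k ≤ 2/ε
  --     from C₁ to C₂ (k ≤ 2/ε stated as k·ε ≤ 2)
  ChordalOn G' (C₁ ∪ C₂) ×
  (Σ ℕ λ k → Σ (Fin (suc k) → Subset n) λ Q →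
     IsPathCliqueTree G' (C₁ ∪ C₂) k Q ×
     (ℕ→ℚ k * ε ℚ.≤ ℕ→ℚ 2) ×
     (Q Data.Fin.zero ≡ C₁) × (Q (Data.Fin.fromℕ k) ≡ C₂)) ×
  (∀ C → IsClique G C → C ⊆ (C₁ ∪ C₂) →
     Σ (Subset n) λ C' → IsMaximalClique G' C' ×
       (ℕ→ℚ ∣ C ─ C' ∣ ℚ.≤ ε * ℕ→ℚ n))

module Submission where

-- Write A = C₁ ∖ C₂, B = C₂ ∖ C₁ and I = C₁ ∩ C₂.  Chordality of G forbids
-- an induced 4-cycle a–b–b'–a' with a, a' ∈ A and b, b' ∈ B, so the
-- B-neighbourhoods of the vertices of A are nested: deg a ≤ deg a' implies
-- N(a) ⊆ N(a').  With M = ⌊εn⌋ the vertices of A are put into buckets by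
-- ⌊deg a / (M+1)⌋, and an edge a–b (a ∈ A, b ∈ B) is kept iff b is adjacent
-- to the whole bucket of a.  With the ranks μ a (occupied buckets below that
-- of a) and ρ b (occupied buckets not entirely adjacent to b), the kept
-- edges are exactly those with ρ b ≤ μ a.  Consequently
--   * every a ∈ A loses at most M edges, so Δ(G,G') ≤ nM/n² ≤ ε;
--   * non-edges of G'[C₁ ∪ C₂] join A to B and never cross, so this graph
--     has no induced cycle of length ≥ 4;
--   * its maximal cliques are Q t = I ∪ {a ∣ t ≤ μ a} ∪ {b ∣ ρ b ≤ t} for
--     t = 0,…,k, a path from C₁ to C₂ with k ≤ ⌈n/(M+1)⌉ ≤ 2/ε;
--   * a clique C ⊆ C₁ ∪ C₂ of G loses in G' only deleted neighbours of the
--     A-vertex of C of least rank, i.e. at most M vertices.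

open import Defs hiding (sym)
open import Data.Nat using (ℕ; zero; suc; _+_; _*_; _∸_; _≤_; z≤n; s≤s; _≤ᵇ_; _<ᵇ_; _≡ᵇ_; _⊓_; _≤?_; _<?_) renaming (_<_ to _<ₙ_)
open import Data.Nat.Properties
open import Algebra.Properties.CommutativeSemigroup +-commutativeSemigroup using (interchange)
open import Data.Nat.DivMod using (_/_; _%_; m≡m%n+[m/n]*n; m%n<n; /-monoˡ-≤; m/n≤m; m/n*n≤m)
open import Data.Fin using (Fin; zero; suc; toℕ; fromℕ; fromℕ<; #_)
open import Data.Fin.Properties using (toℕ-injective; toℕ<n; toℕ-fromℕ; toℕ-fromℕ<)
import Data.Fin as F
open import Data.Fin.Subset using (Subset; _∈_; _⊆_; _∩_; _∪_; _─_; ∣_∣)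
open import Data.Fin.Subset.Properties using (⊆-antisym; ∈⊤)
open import Data.Bool using (Bool; true; false; _∧_; _∨_; not; _xor_; if_then_else_; T)
open import Data.Bool.Properties using (∧-zeroʳ; ∧-identityʳ; ∨-identityʳ; ∧-comm; not-¬)
open import Data.Vec using ([]; _∷_; lookup; tabulate)
open import Data.Vec.Properties using ([]=⇒lookup; lookup⇒[]=; lookup∘tabulate; tabulate∘lookup; tabulate-cong)
import Data.List as L
open import Data.Nat.ListAction using (sum)
open import Data.Product using (Σ; _×_; _,_; ∃; proj₁; proj₂)
open import Data.Sum using (_⊎_; inj₁; inj₂; [_,_]′)
open import Data.Empty using (⊥; ⊥-elim)
open import Data.Unit using (tt)
open import Relation.Binary.Definitions using (tri<; tri≈; tri>)
open import Relation.Binary.PropositionalEquality using (_≡_; _≢_; refl; sym; trans; cong; cong₂; subst; subst₂)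
open import Relation.Nullary using (¬_; Dec; yes; no; does)
open import Relation.Nullary.Decidable using (_×-dec_; _⊎-dec_; dec-true)
open import Function.Definitions using (Injective)
open import Function.Bundles using (Equivalence; mk⇔)
open import Data.Rational using (ℚ; 0ℚ; 1ℚ; _<_)
import Data.Rational as Q
import Data.Rational.Properties as QP
import Data.Integer as Z
import Data.Integer.Properties as ZP
import Data.Rational.Unnormalised as U
import Data.Rational.Unnormalised.Properties as UP
import Data.Nat.Coprimality as CP

true≢false : true ≢ false
true≢false ()

bool-cases : ∀ (b : Bool) → (b ≡ true) ⊎ (b ≡ false)
bool-cases true = inj₁ refl
bool-cases false = inj₂ refl

≢true⇒false : ∀ {b} → ¬ (b ≡ true) → b ≡ false
≢true⇒false {true} h = ⊥-elim (h refl)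
≢true⇒false {false} h = refl

∧⁻ˡ : ∀ {a b} → a ∧ b ≡ true → a ≡ true
∧⁻ˡ {true} _ = refl

∧⁻ʳ : ∀ {a b} → a ∧ b ≡ true → b ≡ true
∧⁻ʳ {true} e = e

∧⁺ : ∀ {a b} → a ≡ true → b ≡ true → a ∧ b ≡ true
∧⁺ refl refl = refl

∧-false⁻ : ∀ a {b} → a ≡ true → a ∧ b ≡ false → b ≡ false
∧-false⁻ true refl e = e

∨⁻ : ∀ {a b} → a ∨ b ≡ true → (a ≡ true) ⊎ (b ≡ true)
∨⁻ {true} _ = inj₁ refl
∨⁻ {false} e = inj₂ e

∨⁺ˡ : ∀ {a} b → a ≡ true → a ∨ b ≡ true
∨⁺ˡ b refl = refl

∨⁺ʳ : ∀ a {b} → b ≡ true → a ∨ b ≡ true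
∨⁺ʳ true _ = refl
∨⁺ʳ false e = e

∨-false⁻ : ∀ {a b} → a ∨ b ≡ false → (a ≡ false) × (b ≡ false)
∨-false⁻ {false} e = refl , e

not-true⇒false : ∀ {a} → not a ≡ true → a ≡ false
not-true⇒false {false} _ = refl

false⇒not-true : ∀ {a} → a ≡ false → not a ≡ true
false⇒not-true refl = refl

not-false⇒true : ∀ {a} → not a ≡ false → a ≡ true
not-false⇒true {true} _ = refl

≤⇒≤ᵇ-true : ∀ {a b} → a ≤ b → (a ≤ᵇ b) ≡ true
≤⇒≤ᵇ-true {a} {b} h with a ≤ᵇ b | ≤⇒≤ᵇ h
... | true | _ = refl

≤ᵇ-true⇒≤ : ∀ {a b} → (a ≤ᵇ b) ≡ true → a ≤ b
≤ᵇ-true⇒≤ {a} {b} e = ≤ᵇ⇒≤ a b (subst T (sym e) tt)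

>⇒≤ᵇ-false : ∀ {a b} → b <ₙ a → (a ≤ᵇ b) ≡ false
>⇒≤ᵇ-false h = ≢true⇒false (λ e → <⇒≱ h (≤ᵇ-true⇒≤ e))

≤ᵇ-false⇒> : ∀ {a b} → (a ≤ᵇ b) ≡ false → b <ₙ a
≤ᵇ-false⇒> e = ≰⇒> (λ h → true≢false (trans (sym (≤⇒≤ᵇ-true h)) e))

<ᵇ-true⇒< : ∀ {a b} → (a <ᵇ b) ≡ true → a <ₙ b
<ᵇ-true⇒< {a} {b} e = <ᵇ⇒< a b (subst T (sym e) tt)

<⇒<ᵇ-true : ∀ {a b} → a <ₙ b → (a <ᵇ b) ≡ true
<⇒<ᵇ-true {a} {b} lt with a <ᵇ b | <⇒<ᵇ lt
... | true | _ = refl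

<⇒flipped-<ᵇ-false : ∀ {a b} → a <ₙ b → (b <ᵇ a) ≡ false
<⇒flipped-<ᵇ-false a<b = ≢true⇒false (λ e → <-asym a<b (<ᵇ-true⇒< e))

search : ∀ {n} (p : Fin n → Bool) → (Σ (Fin n) λ x → p x ≡ true) ⊎ (∀ x → p x ≡ false)
search {zero} p = inj₂ (λ ())
search {suc n} p with p zero in e
... | true = inj₁ (zero , e)
... | false with search (λ x → p (suc x))
...   | inj₁ (x , px) = inj₁ (suc x , px)
...   | inj₂ h = inj₂ λ { zero → e ; (suc x) → h x }

allB : ∀ {n} → (Fin n → Bool) → Bool
allB {zero} g = true
allB {suc n} g = g zero ∧ allB (λ x → g (suc x))

allB⁻ : ∀ {n} (g : Fin n → Bool) → allB g ≡ true → ∀ y → g y ≡ true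
allB⁻ g e zero = ∧⁻ˡ e
allB⁻ g e (suc y) = allB⁻ (λ x → g (suc x)) (∧⁻ʳ {g zero} e) y

allB⁺ : ∀ {n} (g : Fin n → Bool) → (∀ y → g y ≡ true) → allB g ≡ true
allB⁺ {zero} g h = refl
allB⁺ {suc n} g h = ∧⁺ (h zero) (allB⁺ (λ x → g (suc x)) (λ y → h (suc y)))

anyB : ∀ {n} → (Fin n → Bool) → Bool
anyB g = not (allB (λ x → not (g x)))

anyB⁻ : ∀ {n} (g : Fin n → Bool) → anyB g ≡ true → Σ (Fin n) λ x → g x ≡ true
anyB⁻ g e with search g
... | inj₁ w = w
... | inj₂ h = ⊥-elim (true≢false (trans (sym e) (cong not (allB⁺ _ (λ y → false⇒not-true (h y))))))

anyB⁺ : ∀ {n} (g : Fin n → Bool) x → g x ≡ true → anyB g ≡ true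
anyB⁺ g x gx with bool-cases (allB (λ x → not (g x)))
... | inj₁ e = ⊥-elim (true≢false (trans (sym gx) (not-true⇒false (allB⁻ _ e x))))
... | inj₂ e rewrite e = refl

count : ∀ {n} → (Fin n → Bool) → ℕ
count {zero} f = 0
count {suc n} f = (if f zero then 1 else 0) + count (λ x → f (suc x))

_⇒ᵇ_ : ∀ {n} → (Fin n → Bool) → (Fin n → Bool) → Set
f ⇒ᵇ g = ∀ x → f x ≡ true → g x ≡ true

count-mono : ∀ {n} (f g : Fin n → Bool) → f ⇒ᵇ g → count f ≤ count g
count-mono {zero} f g h = z≤n
count-mono {suc n} f g h with f zero in e1 | g zero in e2
... | true | true = s≤s (count-mono _ _ (λ x → h (suc x)))
... | true | false = ⊥-elim (true≢false (trans (sym (h zero e1)) e2))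
... | false | true = m≤n⇒m≤1+n (count-mono _ _ (λ x → h (suc x)))
... | false | false = count-mono _ _ (λ x → h (suc x))

count-strict : ∀ {n} (f g : Fin n → Bool) → f ⇒ᵇ g → (x : Fin n) → g x ≡ true → f x ≡ false → count f <ₙ count g
count-strict {suc n} f g h zero gx fx rewrite gx | fx = s≤s (count-mono _ _ (λ x → h (suc x)))
count-strict {suc n} f g h (suc x) gx fx with f zero in e1 | g zero in e2
... | true | true = s≤s (count-strict _ _ (λ y → h (suc y)) x gx fx)
... | true | false = ⊥-elim (true≢false (trans (sym (h zero e1)) e2))
... | false | true = m≤n⇒m≤1+n (count-strict _ _ (λ y → h (suc y)) x gx fx)
... | false | false = count-strict _ _ (λ y → h (suc y)) x gx fx

count-witness : ∀ {n} (f g : Fin n → Bool) → count f <ₙ count g → Σ (Fin n) λ x → g x ≡ true × f x ≡ false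
count-witness f g lt with search (λ x → g x ∧ not (f x))
... | inj₁ (x , e) = x , ∧⁻ˡ e , not-true⇒false (∧⁻ʳ {g x} e)
... | inj₂ h = ⊥-elim (<⇒≱ lt (count-mono g f λ x gx → lem (f x) (h x) gx))
  where lem : ∀ b {c} → c ∧ not b ≡ false → c ≡ true → b ≡ true
        lem true _ _ = refl
        lem false e refl = ⊥-elim (true≢false e)

count≤n : ∀ {n} (f : Fin n → Bool) → count f ≤ n
count≤n {zero} f = z≤n
count≤n {suc n} f with f zero
... | true = s≤s (count≤n _)
... | false = m≤n⇒m≤1+n (count≤n _)

count-false : ∀ {n} → count {n} (λ _ → false) ≡ 0
count-false {zero} = refl
count-false {suc n} = count-false {n}

count-disjoint : ∀ {n} (f g h : Fin n → Bool) → f ⇒ᵇ h → g ⇒ᵇ h → (∀ x → f x ≡ true → g x ≡ false) → count f + count g ≤ count h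
count-disjoint {zero} f g h _ _ _ = z≤n
count-disjoint {suc n} f g h fh gh d with f zero in e1 | g zero in e2 | h zero in e3
  | count-disjoint (λ x → f (suc x)) (λ x → g (suc x)) (λ x → h (suc x)) (λ x → fh (suc x)) (λ x → gh (suc x)) (λ x → d (suc x))
... | true | true | _ | _ = ⊥-elim (true≢false (trans (sym e2) (d zero e1)))
... | true | false | true | ih = s≤s ih
... | true | false | false | ih = ⊥-elim (true≢false (trans (sym (fh zero e1)) e3))
... | false | true | true | ih = subst (_≤ suc (count (λ x → h (suc x)))) (sym (+-suc (count (λ x → f (suc x))) (count (λ x → g (suc x))))) (s≤s ih)
... | false | true | false | ih = ⊥-elim (true≢false (trans (sym (gh zero e2)) e3))
... | false | false | true | ih = m≤n⇒m≤1+n ih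
... | false | false | false | ih = ih

argmin : ∀ {n} (p : Fin n → Bool) (f : Fin n → ℕ) (x : Fin n) → p x ≡ true →
         Σ (Fin n) λ y → (p y ≡ true) × (∀ z → p z ≡ true → f y ≤ f z)
argmin {n} p f x px = go (f x) x px ≤-refl
  where
  go : (k : ℕ) (x : Fin n) → p x ≡ true → f x ≤ k → Σ (Fin n) λ y → (p y ≡ true) × (∀ z → p z ≡ true → f y ≤ f z)
  go zero x px le = x , px , λ z _ → subst (_≤ f z) (sym (n≤0⇒n≡0 le)) z≤n
  go (suc k) x px le with search (λ z → p z ∧ (f z <ᵇ f x))
  ... | inj₁ (z , e) = go k z (∧⁻ˡ e) (≤-pred (≤-trans (<ᵇ-true⇒< (∧⁻ʳ e)) le))
  ... | inj₂ h = x , px , λ z pz → ≮⇒≥ (λ lt → true≢false (trans (sym (∧⁺ pz (<⇒<ᵇ-true lt))) (h z)))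

sumF : ∀ {n} → (Fin n → ℕ) → ℕ
sumF {zero} h = 0
sumF {suc n} h = h zero + sumF (λ x → h (suc x))

sum-tabulate : ∀ {n} {A : Set} (f : Fin n → A) (h : A → ℕ) → sum (L.map h (L.tabulate f)) ≡ sumF (λ x → h (f x))
sum-tabulate {zero} f h = refl
sum-tabulate {suc n} f h = cong (h (f zero) +_) (sum-tabulate (λ x → f (suc x)) h)

sumF-const : ∀ {n} (c : ℕ) → sumF {n} (λ _ → c) ≡ n * c
sumF-const {zero} c = refl
sumF-const {suc n} c = cong (c +_) (sumF-const {n} c)

sumF-cong : ∀ {n} (h h' : Fin n → ℕ) → (∀ x → h x ≡ h' x) → sumF h ≡ sumF h'
sumF-cong {zero} h h' eq = refl
sumF-cong {suc n} h h' eq = cong₂ _+_ (eq zero) (sumF-cong _ _ (λ x → eq (suc x)))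

sumF-mono : ∀ {n} (h h' : Fin n → ℕ) → (∀ x → h x ≤ h' x) → sumF h ≤ sumF h'
sumF-mono {zero} h h' le = z≤n
sumF-mono {suc n} h h' le = +-mono-≤ (le zero) (sumF-mono _ _ (λ x → le (suc x)))

sumF-+ : ∀ {n} (h h' : Fin n → ℕ) → sumF (λ x → h x + h' x) ≡ sumF h + sumF h'
sumF-+ {zero} h h' = refl
sumF-+ {suc n} h h' = trans (cong (h zero + h' zero +_) (sumF-+ (λ x → h (suc x)) (λ x → h' (suc x))))
                            (interchange (h zero) (h' zero) _ _)

sumF-swap : ∀ {n k} (F : Fin n → Fin k → ℕ) → sumF (λ u → sumF (λ v → F u v)) ≡ sumF (λ v → sumF (λ u → F u v))
sumF-swap {zero} {k} F = sym (trans (sumF-const {k} 0) (*-zeroʳ k))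
sumF-swap {suc n} {k} F = trans (cong (sumF (λ v → F zero v) +_) (sumF-swap (λ u v → F (suc u) v)))
  (sym (sumF-+ (λ v → F zero v) (λ v → sumF (λ u → F (suc u) v))))

sumF-indicator : ∀ {n} (f : Fin n → Bool) → sumF (λ x → if f x then 1 else 0) ≡ count f
sumF-indicator {zero} f = refl
sumF-indicator {suc n} f = cong ((if f zero then 1 else 0) +_) (sumF-indicator (λ x → f (suc x)))

-- The maximum of f over {x ∣ p x}, or 0 if that set is empty.
maxF : ∀ {n} (p : Fin n → Bool) (f : Fin n → ℕ) →
       Σ ℕ λ t → (∀ z → p z ≡ true → f z ≤ t) × ((t ≡ 0) ⊎ (Σ (Fin n) λ z → (p z ≡ true) × (f z ≡ t)))
maxF {n} p f with search p
... | inj₂ h = 0 , (λ z pz → ⊥-elim (true≢false (trans (sym pz) (h z)))) , inj₁ refl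
... | inj₁ (x , px) = let (y , py , hy) = argmin p (λ z → sumF f ∸ f z) x px in
        f y , (λ z pz → flip-min z (hy z pz)) , inj₂ (y , py , refl)
  where
  f≤sum : ∀ {n} (f : Fin n → ℕ) z → f z ≤ sumF f
  f≤sum f zero = m≤m+n _ _
  f≤sum f (suc z) = ≤-trans (f≤sum (λ x → f (suc x)) z) (m≤n+m _ (f zero))
  flip-min : ∀ z {y} → sumF f ∸ f y ≤ sumF f ∸ f z → f z ≤ f y
  flip-min z le = ≮⇒≥ λ lt → <⇒≱ (∸-monoʳ-< lt (f≤sum f z)) le

countBelow : (ℕ → Bool) → ℕ → ℕ
countBelow p zero = 0
countBelow p (suc x) = countBelow p x + (if p x then 1 else 0)

countBelow-mono : ∀ p {x y} → x ≤ y → countBelow p x ≤ countBelow p y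
countBelow-mono p {x} {zero} z≤n = ≤-refl
countBelow-mono p {x} {suc y} le with m≤n⇒m<n∨m≡n le
... | inj₂ refl = ≤-refl
... | inj₁ (s≤s lt) = ≤-trans (countBelow-mono p lt) (m≤m+n (countBelow p y) _)

countBelow-step : ∀ p x → p x ≡ true → countBelow p (suc x) ≡ suc (countBelow p x)
countBelow-step p x e rewrite e = +-comm (countBelow p x) 1

countBelow-all : ∀ x → countBelow (λ _ → true) x ≡ x
countBelow-all zero = refl
countBelow-all (suc x) = trans (+-comm (countBelow (λ _ → true) x) 1) (cong suc (countBelow-all x))

countBelow-pointwise : ∀ p q x → (∀ j → j <ₙ x → p j ≡ true → q j ≡ true) → countBelow p x ≤ countBelow q x
countBelow-pointwise p q zero h = z≤n
countBelow-pointwise p q (suc x) h with p x in e1 | q x in e2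
... | true | true = +-mono-≤ (countBelow-pointwise p q x (λ j lt → h j (m<n⇒m<1+n lt))) ≤-refl
... | true | false = ⊥-elim (true≢false (trans (sym (h x ≤-refl e1)) e2))
... | false | true = +-mono-≤ (countBelow-pointwise p q x (λ j lt → h j (m<n⇒m<1+n lt))) z≤n
... | false | false = +-mono-≤ (countBelow-pointwise p q x (λ j lt → h j (m<n⇒m<1+n lt))) z≤n

countBelow-embed : ∀ p q N x → (∀ j → j <ₙ N → q j ≡ true → (p j ≡ true) × (j <ₙ x)) → countBelow q N ≤ countBelow p x
countBelow-embed p q N x h = ≤-trans (go N h) (countBelow-mono p (m⊓n≤n N x))
  where
  go : ∀ N → (∀ j → j <ₙ N → q j ≡ true → (p j ≡ true) × (j <ₙ x)) → countBelow q N ≤ countBelow p (N ⊓ x)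
  go zero h = z≤n
  go (suc N) h with q N in e
  ... | true = let (pN , N<x) = h N ≤-refl e
                   ih = go N (λ j lt qj → h j (m<n⇒m<1+n lt) qj)
               in begin
                    countBelow q N + 1        ≡⟨ +-comm _ 1 ⟩
                    suc (countBelow q N)      ≤⟨ s≤s (subst (λ z → countBelow q N ≤ countBelow p z) (m≤n⇒m⊓n≡m (<⇒≤ N<x)) ih) ⟩
                    suc (countBelow p N)      ≡⟨ countBelow-step p N pN ⟨
                    countBelow p (suc N)      ≡⟨ cong (countBelow p) (m≤n⇒m⊓n≡m N<x) ⟨
                    countBelow p (suc N ⊓ x)  ∎
    where open ≤-Reasoning
  ... | false = ≤-trans (≤-reflexive (+-identityʳ _))
                  (≤-trans (go N (λ j lt qj → h j (m<n⇒m<1+n lt) qj)) (countBelow-mono p (⊓-monoˡ-≤ x (n≤1+n N))))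

countBelow-bounded : ∀ p N x → (∀ j → j <ₙ N → p j ≡ true → j <ₙ x) → countBelow p N ≤ x
countBelow-bounded p N x h =
  subst (countBelow p N ≤_) (countBelow-all x) (countBelow-embed (λ _ → true) p N x (λ j lt pj → refl , h j lt pj))

countBelow-positive : ∀ q j N → q j ≡ true → j <ₙ N → 1 ≤ countBelow q N
countBelow-positive q j N e lt = ≤-trans (subst (1 ≤_) (sym (countBelow-step q j e)) (s≤s z≤n)) (countBelow-mono q lt)

-- The t-th point of p below N (counting from 0).
countBelow-select : ∀ p N t → t <ₙ countBelow p N → Σ ℕ λ j → (j <ₙ N) × (p j ≡ true) × (countBelow p j ≡ t)
countBelow-select p zero t ()
countBelow-select p (suc N) t lt with <-cmp t (countBelow p N)
... | tri< t<c _ _ = let (j , j<N , pj , cj) = countBelow-select p N t t<c in j , m<n⇒m<1+n j<N , pj , cj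
... | tri≈ _ refl _ with p N in e
...   | true = N , ≤-refl , e , refl
...   | false = ⊥-elim (<-irrefl (sym (+-identityʳ (countBelow p N))) lt)
countBelow-select p (suc N) t lt | tri> _ _ c>t with p N
...   | true = ⊥-elim (<-irrefl refl (≤-trans lt (subst (_≤ t) (+-comm 1 (countBelow p N)) c>t)))
...   | false = ⊥-elim (<-asym c>t (subst (t <ₙ_) (+-identityʳ _) lt))

∈⇒lookup : ∀ {n} {x : Fin n} {p : Subset n} → x ∈ p → lookup p x ≡ true
∈⇒lookup = []=⇒lookup

lookup⇒∈ : ∀ {n} {x : Fin n} {p : Subset n} → lookup p x ≡ true → x ∈ p
lookup⇒∈ {x = x} {p} = lookup⇒[]= x p

lookup-∪ : ∀ {n} (p q : Subset n) x → lookup (p ∪ q) x ≡ lookup p x ∨ lookup q x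
lookup-∪ (a ∷ p) (b ∷ q) zero = refl
lookup-∪ (a ∷ p) (b ∷ q) (suc x) = lookup-∪ p q x

lookup-∩ : ∀ {n} (p q : Subset n) x → lookup (p ∩ q) x ≡ lookup p x ∧ lookup q x
lookup-∩ (a ∷ p) (b ∷ q) zero = refl
lookup-∩ (a ∷ p) (b ∷ q) (suc x) = lookup-∩ p q x

lookup-─ : ∀ {n} (p q : Subset n) x → lookup (p ─ q) x ≡ lookup p x ∧ not (lookup q x)
lookup-─ (a ∷ p) (true ∷ q) zero = sym (∧-zeroʳ a)
lookup-─ (a ∷ p) (false ∷ q) zero = sym (∧-identityʳ a)
lookup-─ (a ∷ p) (b ∷ q) (suc x) = lookup-─ p q x

∣∣≡count : ∀ {n} (p : Subset n) → ∣ p ∣ ≡ count (lookup p)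
∣∣≡count [] = refl
∣∣≡count (true ∷ p) = cong suc (∣∣≡count p)
∣∣≡count (false ∷ p) = ∣∣≡count p

subset-ext : ∀ {n} (p q : Subset n) → (∀ x → lookup p x ≡ lookup q x) → p ≡ q
subset-ext p q h = trans (sym (tabulate∘lookup p)) (trans (tabulate-cong h) (tabulate∘lookup q))

adj-sym : ∀ {n} (H : Graph n) u v {b} → adj H v u ≡ b → adj H u v ≡ b
adj-sym H u v e = trans (Graph.sym H u v) e

adjacent⇒distinct : ∀ {n} (H : Graph n) {u v} → adj H u v ≡ true → u ≢ v
adjacent⇒distinct H {u} e refl = true≢false (trans (sym e) (Graph.irrefl H u))

CliqueB : ∀ {n} → Graph n → (Fin n → Bool) → Set
CliqueB H K = ∀ u v → K u ≡ true → K v ≡ true → u ≢ v → adj H u v ≡ true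

tabulate-clique : ∀ {n} (H : Graph n) (K : Fin n → Bool) → CliqueB H K → IsClique H (tabulate K)
tabulate-clique H K cl u v u∈ v∈ =
  cl u v (trans (sym (lookup∘tabulate K u)) (∈⇒lookup u∈)) (trans (sym (lookup∘tabulate K v)) (∈⇒lookup v∈))

_==_ : ∀ {n} → Fin n → Fin n → Bool
u == x = does (u F.≟ x)

==⇒≡ : ∀ {n} {u x : Fin n} → u == x ≡ true → u ≡ x
==⇒≡ {u = u} {x} e with u F.≟ x
... | yes p = p

==-refl : ∀ {n} (x : Fin n) → x == x ≡ true
==-refl x with x F.≟ x
... | yes _ = refl
... | no ne = ⊥-elim (ne refl)

clique-insert : ∀ {n} (H : Graph n) (K : Fin n → Bool) x → CliqueB H K →
                (∀ y → K y ≡ true → adj H x y ≡ true) → CliqueB H (λ u → K u ∨ (u == x))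
clique-insert H K x cl adjx u v ku kv u≢v with ∨⁻ ku | ∨⁻ kv
... | inj₁ a | inj₁ b = cl u v a b u≢v
... | inj₁ a | inj₂ b = subst (λ w → adj H u w ≡ true) (sym (==⇒≡ b)) (adj-sym H u x (adjx u a))
... | inj₂ a | inj₁ b = subst (λ w → adj H w v ≡ true) (sym (==⇒≡ a)) (adjx v b)
... | inj₂ a | inj₂ b = ⊥-elim (u≢v (trans (==⇒≡ a) (sym (==⇒≡ b))))

addable : ∀ {n} → Graph n → (Fin n → Bool) → Fin n → Bool
addable H K x = not (K x) ∧ allB (λ y → not (K y) ∨ adj H x y)

addable⁻ : ∀ {n} (H : Graph n) K x → addable H K x ≡ true → (K x ≡ false) × (∀ y → K y ≡ true → adj H x y ≡ true)
addable⁻ H K x e = not-true⇒false (∧⁻ˡ e) , adjacent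
  where
  adjacent : ∀ y → K y ≡ true → adj H x y ≡ true
  adjacent y ky with ∨⁻ (allB⁻ _ (∧⁻ʳ {not (K x)} e) y)
  ... | inj₁ nk = ⊥-elim (true≢false (trans (sym ky) (not-true⇒false nk)))
  ... | inj₂ a = a

addable⁺ : ∀ {n} (H : Graph n) K x → K x ≡ false → (∀ y → K y ≡ true → adj H x y ≡ true) → addable H K x ≡ true
addable⁺ H K x kx adjacent = ∧⁺ (false⇒not-true kx) (allB⁺ _ λ y → lemma y (bool-cases (K y)))
  where
  lemma : ∀ y → (K y ≡ true) ⊎ (K y ≡ false) → not (K y) ∨ adj H x y ≡ true
  lemma y (inj₁ ky) rewrite ky = adjacent y ky
  lemma y (inj₂ ky) rewrite ky = refl

-- Every clique extends to a maximal clique: add addable vertices while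
-- there are any.  The fuel f, with n ≤ count K + f, bounds the number of steps.
extend : ∀ {n} (H : Graph n) (K : Fin n → Bool) → CliqueB H K →
         Σ (Subset n) λ C → IsMaximalClique H C × (K ⇒ᵇ lookup C)
extend {n} H K₀ cl₀ = grow n K₀ cl₀ (m≤n+m n (count K₀)) (λ _ e → e)
  where
  grow : (f : ℕ) (K : Fin n → Bool) → CliqueB H K → n ≤ count K + f → K₀ ⇒ᵇ K →
         Σ (Subset n) λ C → IsMaximalClique H C × (K₀ ⇒ᵇ lookup C)
  grow f K cl bound K₀⇒K with search (addable H K)
  ... | inj₁ (x , e) = step f bound
    where
    K' : Fin n → Bool
    K' u = K u ∨ (u == x)
    K⇒K' : K ⇒ᵇ K'
    K⇒K' u ku = ∨⁺ˡ _ ku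
    larger : count K <ₙ count K'
    larger = count-strict K K' K⇒K' x (∨⁺ʳ (K x) (==-refl x)) (proj₁ (addable⁻ H K x e))
    step : (f : ℕ) → n ≤ count K + f → Σ (Subset n) λ C → IsMaximalClique H C × (K₀ ⇒ᵇ lookup C)
    step zero bound = ⊥-elim (<⇒≱ (≤-<-trans (subst (n ≤_) (+-identityʳ _) bound) larger) (count≤n K'))
    step (suc f) bound = grow f K' (clique-insert H K x cl (proj₂ (addable⁻ H K x e)))
      (≤-trans bound (subst (_≤ count K' + f) (sym (+-suc (count K) f)) (+-monoˡ-≤ f larger)))
      (λ y k₀ → K⇒K' y (K₀⇒K y k₀))
  ... | inj₂ none = tabulate K , (tabulate-clique H K cl , maximal) , λ x k₀ → trans (lookup∘tabulate K x) (K₀⇒K x k₀)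
    where
    maximal : ∀ D → IsClique H D → tabulate K ⊆ D → D ⊆ tabulate K
    maximal D clD K⊆D {x} x∈D with bool-cases (K x)
    ... | inj₁ kx = lookup⇒∈ (trans (lookup∘tabulate K x) kx)
    ... | inj₂ kx = ⊥-elim (true≢false (trans (sym (addable⁺ H K x kx adjacent)) (none x)))
      where
      adjacent : ∀ y → K y ≡ true → adj H x y ≡ true
      adjacent y ky = clD x y x∈D (K⊆D (lookup⇒∈ (trans (lookup∘tabulate K y) ky)))
                        (λ x≡y → true≢false (trans (sym ky) (trans (cong K (sym x≡y)) kx)))

-- A vertex outside a maximal clique C has a non-neighbour in C (otherwise
-- C ∪ {x} would be a larger clique).
outside-maximal : ∀ {n} (H : Graph n) (C : Subset n) → IsMaximalClique H C → ∀ x → lookup C x ≡ false →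
                  Σ (Fin n) λ u → (lookup C u ≡ true) × (adj H u x ≡ false)
outside-maximal {n} H C (clC , maxC) x cx with search (λ u → lookup C u ∧ not (adj H u x))
... | inj₁ (u , e) = u , ∧⁻ˡ e , not-true⇒false (∧⁻ʳ {lookup C u} e)
... | inj₂ none = ⊥-elim (true≢false (trans (sym x∈C) cx))
  where
  adjacent : ∀ u → lookup C u ≡ true → adj H x u ≡ true
  adjacent u cu with bool-cases (adj H u x)
  ... | inj₁ e = adj-sym H x u e
  ... | inj₂ e = ⊥-elim (true≢false (trans (sym (∧⁺ cu (false⇒not-true e))) (none u)))
  D : Subset n
  D = tabulate (λ u → lookup C u ∨ (u == x))
  clD : IsClique H D
  clD = tabulate-clique H _ (clique-insert H (lookup C) x (λ u v cu cv → clC u v (lookup⇒∈ cu) (lookup⇒∈ cv)) adjacent)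
  x∈C : lookup C x ≡ true
  x∈C = ∈⇒lookup (maxC D clD (λ {y} y∈C → lookup⇒∈ (trans (lookup∘tabulate _ y) (∨⁺ˡ _ (∈⇒lookup y∈C))))
                              (lookup⇒∈ (trans (lookup∘tabulate _ x) (∨⁺ʳ _ (==-refl x)))))

-- Induced cycles.  CycAdj is decidable, so an adjacency pattern can be
-- compared with the cycle pattern as an equation between Booleans.

cycAdj? : ∀ {k} (i j : Fin k) → Dec (CycAdj i j)
cycAdj? {k} i j = (toℕ j ≟ suc (toℕ i)) ⊎-dec (toℕ i ≟ suc (toℕ j)) ⊎-dec
                  ((toℕ i ≟ 0) ×-dec (suc (toℕ j) ≟ k)) ⊎-dec ((toℕ j ≟ 0) ×-dec (suc (toℕ i) ≟ k))

does-true⇒ : ∀ {P : Set} (d : Dec P) → does d ≡ true → P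
does-true⇒ (yes p) _ = p

does-false⇒ : ∀ {P : Set} (d : Dec P) → does d ≡ false → ¬ P
does-false⇒ (no ¬p) _ = ¬p

injective4 : ∀ {A : Set} (f : Fin 4 → A) → f (# 0) ≢ f (# 1) → f (# 0) ≢ f (# 2) → f (# 0) ≢ f (# 3) →
             f (# 1) ≢ f (# 2) → f (# 1) ≢ f (# 3) → f (# 2) ≢ f (# 3) → Injective _≡_ _≡_ f
injective4 f d01 d02 d03 d12 d13 d23 = inj
  where
  inj : Injective _≡_ _≡_ f
  inj {zero} {zero} _ = refl
  inj {zero} {suc zero} e = ⊥-elim (d01 e)
  inj {zero} {suc (suc zero)} e = ⊥-elim (d02 e)
  inj {zero} {suc (suc (suc zero))} e = ⊥-elim (d03 e)
  inj {suc zero} {zero} e = ⊥-elim (d01 (sym e))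
  inj {suc zero} {suc zero} _ = refl
  inj {suc zero} {suc (suc zero)} e = ⊥-elim (d12 e)
  inj {suc zero} {suc (suc (suc zero))} e = ⊥-elim (d13 e)
  inj {suc (suc zero)} {zero} e = ⊥-elim (d02 (sym e))
  inj {suc (suc zero)} {suc zero} e = ⊥-elim (d12 (sym e))
  inj {suc (suc zero)} {suc (suc zero)} _ = refl
  inj {suc (suc zero)} {suc (suc (suc zero))} e = ⊥-elim (d23 e)
  inj {suc (suc (suc zero))} {zero} e = ⊥-elim (d03 (sym e))
  inj {suc (suc (suc zero))} {suc zero} e = ⊥-elim (d13 (sym e))
  inj {suc (suc (suc zero))} {suc (suc zero)} e = ⊥-elim (d23 (sym e))
  inj {suc (suc (suc zero))} {suc (suc (suc zero))} _ = refl

-- Four vertices of S adjacent exactly along the cycle x₀x₁x₂x₃x₀, with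
-- x₀ ≢ x₂ and x₁ ≢ x₃, form an induced 4-cycle of H[S] (consecutive
-- vertices are distinct because they are adjacent).
square : ∀ {n} (H : Graph n) (S : Subset n) (f : Fin 4 → Fin n) → (∀ i → f i ∈ S) →
         (∀ i j → adj H (f i) (f j) ≡ does (cycAdj? i j)) → f (# 0) ≢ f (# 2) → f (# 1) ≢ f (# 3) →
         InducedCycleIn H S 4 f
square H S f f∈S shape d02 d13 =
  injective4 f (adjacent⇒distinct H (shape (# 0) (# 1))) d02 (adjacent⇒distinct H (shape (# 0) (# 3)))
               (adjacent⇒distinct H (shape (# 1) (# 2))) d13 (adjacent⇒distinct H (shape (# 2) (# 3))) ,
  f∈S , λ i j → mk⇔ (λ e → does-true⇒ (cycAdj? i j) (trans (sym (shape i j)) e))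
                    (λ c → trans (shape i j) (dec-true (cycAdj? i j) c))

-- Five Booleans cannot alternate along the odd cycle 0–2–4–1–3–0.
no-odd-alternation : ∀ (s₀ s₁ s₂ s₃ s₄ : Bool) → s₀ ≡ not s₂ → s₂ ≡ not s₄ → s₀ ≡ not s₃ → s₁ ≡ not s₃ → s₁ ≡ not s₄ → ⊥
no-odd-alternation s₀ s₁ s₂ s₃ s₄ e02 e24 e03 e13 e14 = not-¬ (trans (trans e03 (sym e13)) (trans e14 (sym e24))) e02

-- The construction.  G is chordal, C₁ and C₂ are maximal cliques and M is
-- the bucket width parameter (M = ⌊εn⌋ in the theorem).
module Simplification {n : ℕ} (G : Graph n) (chordal : Chordal G) (C₁ C₂ : Subset n)
                      (max₁ : IsMaximalClique G C₁) (max₂ : IsMaximalClique G C₂) (M : ℕ) where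

  c1 c2 inA inB inI : Fin n → Bool
  c1 u = lookup C₁ u
  c2 u = lookup C₂ u
  inA u = c1 u ∧ not (c2 u)
  inB u = c2 u ∧ not (c1 u)
  inI u = c1 u ∧ c2 u

  A⇒c1 : ∀ {u} → inA u ≡ true → c1 u ≡ true
  A⇒c1 e = ∧⁻ˡ e

  A⇒¬c2 : ∀ {u} → inA u ≡ true → c2 u ≡ false
  A⇒¬c2 {u} e = not-true⇒false (∧⁻ʳ {c1 u} e)

  B⇒c2 : ∀ {u} → inB u ≡ true → c2 u ≡ true
  B⇒c2 e = ∧⁻ˡ e

  B⇒¬c1 : ∀ {u} → inB u ≡ true → c1 u ≡ false
  B⇒¬c1 {u} e = not-true⇒false (∧⁻ʳ {c2 u} e)

  A⇒¬B : ∀ {u} → inA u ≡ true → inB u ≡ false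
  A⇒¬B {u} e rewrite A⇒¬c2 e = refl

  B⇒¬A : ∀ {u} → inB u ≡ true → inA u ≡ false
  B⇒¬A {u} e rewrite B⇒¬c1 e = refl

  A≢B : ∀ {u v} → inA u ≡ true → inB v ≡ true → u ≢ v
  A≢B {u} {v} eu ev refl = true≢false (trans (sym (A⇒c1 eu)) (B⇒¬c1 ev))

  clique₁ : ∀ {u v} → c1 u ≡ true → c1 v ≡ true → u ≢ v → adj G u v ≡ true
  clique₁ eu ev u≢v = proj₁ max₁ _ _ (lookup⇒∈ eu) (lookup⇒∈ ev) u≢v

  clique₂ : ∀ {u v} → c2 u ≡ true → c2 v ≡ true → u ≢ v → adj G u v ≡ true
  clique₂ eu ev u≢v = proj₁ max₂ _ _ (lookup⇒∈ eu) (lookup⇒∈ ev) u≢v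

  S : Subset n
  S = C₁ ∪ C₂

  data Part (u : Fin n) : Set where
    partI : c1 u ≡ true → c2 u ≡ true → Part u
    partA : inA u ≡ true → Part u
    partB : inB u ≡ true → Part u

  part : ∀ {u} → u ∈ S → Part u
  part {u} u∈S with bool-cases (c1 u) | bool-cases (c2 u)
  ... | inj₁ x | inj₁ y = partI x y
  ... | inj₁ x | inj₂ y = partA (∧⁺ x (false⇒not-true y))
  ... | inj₂ x | inj₁ y = partB (∧⁺ y (false⇒not-true x))
  ... | inj₂ x | inj₂ y = ⊥-elim (true≢false (trans (sym (trans (sym (lookup-∪ C₁ C₂ u)) (∈⇒lookup u∈S))) (cong₂ _∨_ x y)))

  -- No crossed pair in G: edges a–b, a'–b' and non-edges a–b', a'–b would
  -- make a–b–b'–a' an induced 4-cycle (a, a' ∈ C₁ and b, b' ∈ C₂ are cliques).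
  no-crossed-pair : ∀ a a' b b' → inA a ≡ true → inA a' ≡ true → inB b ≡ true → inB b' ≡ true →
                    adj G a b ≡ true → adj G a' b' ≡ true → adj G a b' ≡ false → adj G a' b ≡ false → ⊥
  no-crossed-pair a a' b b' a∈A a'∈A b∈B b'∈B ab a'b' ab' a'b =
    chordal 4 ≤-refl f (square G _ f (λ _ → ∈⊤) shape (A≢B a∈A b'∈B) (λ e → A≢B a'∈A b∈B (sym e)))
    where
    f : Fin 4 → Fin n
    f zero = a
    f (suc zero) = b
    f (suc (suc zero)) = b'
    f (suc (suc (suc zero))) = a'
    aa' : adj G a a' ≡ true
    aa' = clique₁ (A⇒c1 a∈A) (A⇒c1 a'∈A) (λ e → true≢false (trans (sym ab) (trans (cong (λ z → adj G z b) e) a'b)))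
    bb' : adj G b b' ≡ true
    bb' = clique₂ (B⇒c2 b∈B) (B⇒c2 b'∈B) (λ e → true≢false (trans (sym ab) (trans (cong (adj G a) e) ab')))
    shape : ∀ i j → adj G (f i) (f j) ≡ does (cycAdj? i j)
    shape zero zero = Graph.irrefl G a
    shape zero (suc zero) = ab
    shape zero (suc (suc zero)) = ab'
    shape zero (suc (suc (suc zero))) = aa'
    shape (suc zero) zero = adj-sym G b a ab
    shape (suc zero) (suc zero) = Graph.irrefl G b
    shape (suc zero) (suc (suc zero)) = bb'
    shape (suc zero) (suc (suc (suc zero))) = adj-sym G b a' a'b
    shape (suc (suc zero)) zero = adj-sym G b' a ab'
    shape (suc (suc zero)) (suc zero) = adj-sym G b' b bb'
    shape (suc (suc zero)) (suc (suc zero)) = Graph.irrefl G b'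
    shape (suc (suc zero)) (suc (suc (suc zero))) = adj-sym G b' a' a'b'
    shape (suc (suc (suc zero))) zero = adj-sym G a' a aa'
    shape (suc (suc (suc zero))) (suc zero) = a'b
    shape (suc (suc (suc zero))) (suc (suc zero)) = a'b'
    shape (suc (suc (suc zero))) (suc (suc (suc zero))) = Graph.irrefl G a'

  -- By maximality of C₁ (resp. C₂) each vertex of B (resp. A) has a
  -- non-neighbour in A (resp. B).
  non-neighbour-in-A : ∀ b → inB b ≡ true → Σ (Fin n) λ a → (inA a ≡ true) × (adj G a b ≡ false)
  non-neighbour-in-A b b∈B with outside-maximal G C₁ max₁ b (B⇒¬c1 b∈B)
  ... | u , cu , e with bool-cases (c2 u)
  ...   | inj₁ c2u = ⊥-elim (true≢false (trans (sym (clique₂ c2u (B⇒c2 b∈B) u≢b)) e))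
    where u≢b : u ≢ b
          u≢b u≡b = true≢false (trans (sym cu) (trans (cong c1 u≡b) (B⇒¬c1 b∈B)))
  ...   | inj₂ c2u = u , ∧⁺ cu (false⇒not-true c2u) , e

  non-neighbour-in-B : ∀ a → inA a ≡ true → Σ (Fin n) λ b → (inB b ≡ true) × (adj G a b ≡ false)
  non-neighbour-in-B a a∈A with outside-maximal G C₂ max₂ a (A⇒¬c2 a∈A)
  ... | u , cu , e with bool-cases (c1 u)
  ...   | inj₁ c1u = ⊥-elim (true≢false (trans (sym (clique₁ (A⇒c1 a∈A) c1u a≢u)) (adj-sym G a u e)))
    where a≢u : a ≢ u
          a≢u a≡u = true≢false (trans (sym cu) (trans (cong c2 (sym a≡u)) (A⇒¬c2 a∈A)))
  ...   | inj₂ c1u = u , ∧⁺ cu (false⇒not-true c1u) , adj-sym G a u e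

  nbr : Fin n → Fin n → Bool
  nbr a b = inB b ∧ adj G a b

  deg : Fin n → ℕ
  deg a = count (nbr a)

  deg<|B| : ∀ a → inA a ≡ true → deg a <ₙ count inB
  deg<|B| a a∈A with non-neighbour-in-B a a∈A
  ... | b , b∈B , e = count-strict (nbr a) inB (λ _ e → ∧⁻ˡ e) b b∈B (subst (λ z → inB b ∧ z ≡ false) (sym e) (∧-zeroʳ (inB b)))

  deg<n : ∀ a → inA a ≡ true → deg a <ₙ n
  deg<n a a∈A = <-≤-trans (deg<|B| a a∈A) (count≤n inB)

  nested : ∀ a a' b → inA a ≡ true → inA a' ≡ true → deg a ≤ deg a' → inB b ≡ true → adj G a b ≡ true → adj G a' b ≡ true
  nested a a' b a∈A a'∈A le b∈B ab with bool-cases (adj G a' b)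
  ... | inj₁ e = e
  ... | inj₂ a'b = ⊥-elim (<⇒≱ (count-strict (nbr a') (nbr a) nbr-a'⊆nbr-a b (∧⁺ b∈B ab)
                                  (subst (λ z → inB b ∧ z ≡ false) (sym a'b) (∧-zeroʳ (inB b)))) le)
    where
    nbr-a'⊆nbr-a : nbr a' ⇒ᵇ nbr a
    nbr-a'⊆nbr-a b' e with bool-cases (adj G a b')
    ... | inj₁ x = ∧⁺ (∧⁻ˡ e) x
    ... | inj₂ ab' = ⊥-elim (no-crossed-pair a a' b b' a∈A a'∈A b∈B (∧⁻ˡ e) ab (∧⁻ʳ {inB b'} e) ab' a'b)

  m : ℕ
  m = suc M

  /m-reflects-< : ∀ x y → x / m <ₙ y / m → x <ₙ y
  /m-reflects-< x y lt = ≰⇒> (λ le → <⇒≱ lt (/-monoˡ-≤ m le))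

  /m-equal⇒close : ∀ x y → x / m ≡ y / m → x <ₙ y + m
  /m-equal⇒close x y e = begin-strict
      x                     ≡⟨ m≡m%n+[m/n]*n x m ⟩
      x % m + (x / m) * m   <⟨ +-monoˡ-< ((x / m) * m) (m%n<n x m) ⟩
      m + (x / m) * m       ≡⟨ cong (λ z → m + z * m) e ⟩
      m + (y / m) * m       ≤⟨ +-monoʳ-≤ m (m/n*n≤m y m) ⟩
      m + y                 ≡⟨ +-comm m y ⟩
      y + m                 ∎
    where open ≤-Reasoning

  bucket : Fin n → ℕ
  bucket a = deg a / m

  inBucket : ℕ → Fin n → Bool
  inBucket j a = inA a ∧ (bucket a ≡ᵇ j)

  inBucket⁻ : ∀ {j a} → inBucket j a ≡ true → (inA a ≡ true) × (bucket a ≡ j)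
  inBucket⁻ {j} {a} e = ∧⁻ˡ e , ≡ᵇ⇒≡ (bucket a) j (subst T (sym (∧⁻ʳ {inA a} e)) tt)

  inBucket⁺ : ∀ {a} → inA a ≡ true → inBucket (bucket a) a ≡ true
  inBucket⁺ {a} a∈A = ∧⁺ a∈A (≡ᵇ-refl (bucket a))
    where ≡ᵇ-refl : ∀ x → (x ≡ᵇ x) ≡ true
          ≡ᵇ-refl zero = refl
          ≡ᵇ-refl (suc x) = ≡ᵇ-refl x

  occupied : ℕ → Bool
  occupied j = anyB (inBucket j)

  fullyAdj : ℕ → Fin n → Bool
  fullyAdj j b = allB (λ a → not (inBucket j a) ∨ adj G a b)

  fullyAdj⁻ : ∀ {j b a} → fullyAdj j b ≡ true → inBucket j a ≡ true → adj G a b ≡ true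
  fullyAdj⁻ {j} {b} {a} e a∈j with ∨⁻ (allB⁻ _ e a)
  ... | inj₁ x = ⊥-elim (true≢false (trans (sym a∈j) (not-true⇒false x)))
  ... | inj₂ x = x

  fullyAdj⁺ : ∀ {j b} → (∀ a → inBucket j a ≡ true → adj G a b ≡ true) → fullyAdj j b ≡ true
  fullyAdj⁺ {j} {b} h = allB⁺ _ λ a → lemma a (bool-cases (inBucket j a))
    where lemma : ∀ a → (inBucket j a ≡ true) ⊎ (inBucket j a ≡ false) → not (inBucket j a) ∨ adj G a b ≡ true
          lemma a (inj₁ x) rewrite x = h a x
          lemma a (inj₂ x) rewrite x = refl

  -- Full adjacency to an occupied bucket propagates to all higher buckets,
  -- since degrees in higher buckets are larger (nestedness).
  fullyAdj-up : ∀ j j' b → inB b ≡ true → occupied j ≡ true → fullyAdj j b ≡ true → j ≤ j' → fullyAdj j' b ≡ true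
  fullyAdj-up j j' b b∈B occ full le with anyB⁻ (inBucket j) occ
  ... | a , a∈j = fullyAdj⁺ λ a' a'∈j' → adjacent a' a'∈j' (m≤n⇒m<n∨m≡n le)
    where
    adjacent : ∀ a' → inBucket j' a' ≡ true → (j <ₙ j') ⊎ (j ≡ j') → adj G a' b ≡ true
    adjacent a' a'∈j' (inj₂ refl) = fullyAdj⁻ full a'∈j'
    adjacent a' a'∈j' (inj₁ lt) =
      nested a a' b (proj₁ (inBucket⁻ a∈j)) (proj₁ (inBucket⁻ a'∈j'))
        (<⇒≤ (/m-reflects-< (deg a) (deg a') (subst₂ _<ₙ_ (sym (proj₂ (inBucket⁻ a∈j))) (sym (proj₂ (inBucket⁻ a'∈j'))) lt)))
        b∈B (fullyAdj⁻ full a∈j)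

  bucket-min : ∀ j → occupied j ≡ true → Σ (Fin n) λ a → (inBucket j a ≡ true) × (∀ z → inBucket j z ≡ true → deg a ≤ deg z)
  bucket-min j occ with anyB⁻ (inBucket j) occ
  ... | a , a∈j = argmin (inBucket j) deg a a∈j

  fullyAdj-from-min : ∀ j a b → inBucket j a ≡ true → (∀ z → inBucket j z ≡ true → deg a ≤ deg z) →
                      inB b ≡ true → adj G a b ≡ true → fullyAdj j b ≡ true
  fullyAdj-from-min j a b a∈j amin b∈B ab =
    fullyAdj⁺ λ z z∈j → nested a z b (proj₁ (inBucket⁻ a∈j)) (proj₁ (inBucket⁻ z∈j)) (amin z z∈j) b∈B ab

  μ : Fin n → ℕ
  μ a = countBelow occupied (bucket a)

  unsettled : Fin n → ℕ → Bool
  unsettled b j = occupied j ∧ not (fullyAdj j b)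

  ρ : Fin n → ℕ
  ρ b = countBelow (unsettled b) n

  len : ℕ
  len = countBelow occupied n

  occupied-own : ∀ a → inA a ≡ true → occupied (bucket a) ≡ true
  occupied-own a a∈A = anyB⁺ _ a (inBucket⁺ a∈A)

  bucket<n : ∀ a → inA a ≡ true → bucket a <ₙ n
  bucket<n a a∈A = ≤-<-trans (m/n≤m (deg a) m) (deg<n a a∈A)

  -- By fullyAdj-up the unsettled buckets of b are an initial segment of
  -- the occupied ones: they all lie below any fully adjacent occupied bucket,
  -- and include all occupied buckets up to a not fully adjacent one.
  ρ≤rank : ∀ j b → inB b ≡ true → occupied j ≡ true → fullyAdj j b ≡ true → ρ b ≤ countBelow occupied j
  ρ≤rank j b b∈B occ full = countBelow-embed occupied (unsettled b) n j below
    where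
    below : ∀ i → i <ₙ n → unsettled b i ≡ true → (occupied i ≡ true) × (i <ₙ j)
    below i _ e = ∧⁻ˡ e , ≰⇒> (λ le → true≢false (trans (sym (fullyAdj-up j i b b∈B occ full le)) (not-true⇒false (∧⁻ʳ {occupied i} e))))

  rank<ρ : ∀ j b → inB b ≡ true → j <ₙ n → fullyAdj j b ≡ false → countBelow occupied (suc j) ≤ ρ b
  rank<ρ j b b∈B j<n partial = ≤-trans (countBelow-pointwise occupied (unsettled b) (suc j) up-to-j) (countBelow-mono (unsettled b) j<n)
    where
    up-to-j : ∀ i → i <ₙ suc j → occupied i ≡ true → unsettled b i ≡ true
    up-to-j i lt occ with bool-cases (fullyAdj i b)
    ... | inj₂ x rewrite x = ∧⁺ occ refl
    ... | inj₁ x = ⊥-elim (true≢false (trans (sym (fullyAdj-up i j b b∈B occ x (≤-pred lt))) partial))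

  fullyAdj⇒ρ≤μ : ∀ a b → inA a ≡ true → inB b ≡ true → fullyAdj (bucket a) b ≡ true → ρ b ≤ μ a
  fullyAdj⇒ρ≤μ a b a∈A b∈B = ρ≤rank (bucket a) b b∈B (occupied-own a a∈A)

  partial⇒μ<ρ : ∀ a b → inA a ≡ true → inB b ≡ true → fullyAdj (bucket a) b ≡ false → μ a <ₙ ρ b
  partial⇒μ<ρ a b a∈A b∈B partial =
    subst (_≤ ρ b) (countBelow-step occupied (bucket a) (occupied-own a a∈A)) (rank<ρ (bucket a) b b∈B (bucket<n a a∈A) partial)

  ρ≤len : ∀ b → ρ b ≤ len
  ρ≤len b = countBelow-pointwise (unsettled b) occupied n (λ j _ e → ∧⁻ˡ e)

  μ<len : ∀ a → inA a ≡ true → μ a <ₙ len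
  μ<len a a∈A = <-≤-trans (subst (μ a <ₙ_) (sym (countBelow-step occupied (bucket a) (occupied-own a a∈A))) ≤-refl)
                          (countBelow-mono occupied (bucket<n a a∈A))

  ρ-positive : ∀ b → inB b ≡ true → 1 ≤ ρ b
  ρ-positive b b∈B with non-neighbour-in-A b b∈B
  ... | a , a∈A , e = countBelow-positive (unsettled b) (bucket a) n (∧⁺ (occupied-own a a∈A) (false⇒not-true partial)) (bucket<n a a∈A)
    where partial : fullyAdj (bucket a) b ≡ false
          partial = ≢true⇒false (λ x → true≢false (trans (sym (fullyAdj⁻ x (inBucket⁺ a∈A))) e))

  μ-onto : ∀ t → t <ₙ len → Σ (Fin n) λ a → (inA a ≡ true) × (μ a ≡ t)
  μ-onto t lt with countBelow-select occupied n t lt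
  ... | j , _ , occ , rank≡t with anyB⁻ (inBucket j) occ
  ...   | a , a∈j = a , proj₁ (inBucket⁻ a∈j) , trans (cong (countBelow occupied) (proj₂ (inBucket⁻ a∈j))) rank≡t

  -- With a of least degree in the s-th occupied bucket: if that bucket is
  -- the last one, any b ∈ B ∖ N(a) has ρ b = s+1; otherwise any b in
  -- N(a*) ∖ N(a), for a* of least degree in the next occupied bucket, does.
  ρ-onto : ∀ s → s <ₙ len → Σ (Fin n) λ b → (inB b ≡ true) × (ρ b ≡ suc s)
  ρ-onto s s<len with countBelow-select occupied n s s<len
  ... | j , j<n , occ , rank≡s with bucket-min j occ
  ...   | a , a∈j , amin = last-or-next (suc s <? len)
    where
    a∈A : inA a ≡ true
    a∈A = proj₁ (inBucket⁻ a∈j)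
    above : ∀ b → inB b ≡ true → adj G a b ≡ false → suc s ≤ ρ b
    above b b∈B e = subst (_≤ ρ b) (trans (countBelow-step occupied j occ) (cong suc rank≡s))
                      (rank<ρ j b b∈B j<n (≢true⇒false (λ x → true≢false (trans (sym (fullyAdj⁻ x a∈j)) e))))
    non-nbr : ∀ b → inB b ≡ true → nbr a b ≡ false → adj G a b ≡ false
    non-nbr b b∈B e = subst (λ z → z ∧ adj G a b ≡ false) b∈B e
    last-or-next : Dec (suc s <ₙ len) → Σ (Fin n) λ b → (inB b ≡ true) × (ρ b ≡ suc s)
    last-or-next (no ¬lt) with count-witness (nbr a) inB (deg<|B| a a∈A)
    ... | b , b∈B , e = b , b∈B , ≤-antisym (≤-trans (ρ≤len b) (≮⇒≥ ¬lt)) (above b b∈B (non-nbr b b∈B e))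
    last-or-next (yes lt) with countBelow-select occupied n (suc s) lt
    ... | j* , _ , occ* , rank*≡s+1 with bucket-min j* occ*
    ...   | a* , a*∈j* , a*min with count-witness (nbr a) (nbr a*) deg<deg*
      where
      j<j* : j <ₙ j*
      j<j* = ≰⇒> (λ le → <-irrefl refl (≤-trans (subst (_≤ countBelow occupied j) rank*≡s+1 (countBelow-mono occupied le)) (≤-reflexive rank≡s)))
      deg<deg* : deg a <ₙ deg a*
      deg<deg* = /m-reflects-< (deg a) (deg a*) (subst₂ _<ₙ_ (sym (proj₂ (inBucket⁻ a∈j))) (sym (proj₂ (inBucket⁻ a*∈j*))) j<j*)
    ...     | b , b∈N* , e = b , ∧⁻ˡ b∈N* ,
      ≤-antisym (subst (ρ b ≤_) rank*≡s+1 (ρ≤rank j* b (∧⁻ˡ b∈N*) occ* (fullyAdj-from-min j* a* b a*∈j* a*min (∧⁻ˡ b∈N*) (∧⁻ʳ {inB b} b∈N*))))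
                (above b (∧⁻ˡ b∈N*) (non-nbr b (∧⁻ˡ b∈N*) e))

  -- Edges a–b of G with b not fully adjacent to the bucket of a; these are
  -- the edges deleted at a.  They avoid N(a°) for the least-degree vertex a°
  -- of that bucket, and deg a < deg a° + m, so there are at most M of them.
  deleted : Fin n → Fin n → Bool
  deleted a b = nbr a b ∧ not (fullyAdj (bucket a) b)

  deleted-bound : ∀ a → inA a ≡ true → count (deleted a) ≤ M
  deleted-bound a a∈A with bucket-min (bucket a) (occupied-own a a∈A)
  ... | a° , a°∈j , a°min = ≤-pred (+-cancelʳ-< (deg a°) (count (deleted a)) m (≤-<-trans (count-disjoint (deleted a) (nbr a°) (nbr a) del⊆N N°⊆N disjoint) close))
    where
    del⊆N : deleted a ⇒ᵇ nbr a
    del⊆N b e = ∧⁻ˡ e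
    N°⊆N : nbr a° ⇒ᵇ nbr a
    N°⊆N b e = ∧⁺ (∧⁻ˡ e) (nested a° a b (proj₁ (inBucket⁻ a°∈j)) a∈A (a°min a (inBucket⁺ a∈A)) (∧⁻ˡ e) (∧⁻ʳ {inB b} e))
    disjoint : ∀ b → deleted a b ≡ true → nbr a° b ≡ false
    disjoint b e = ≢true⇒false λ x → true≢false (trans (sym (fullyAdj-from-min (bucket a) a° b a°∈j a°min (∧⁻ˡ x) (∧⁻ʳ {inB b} x))) (not-true⇒false (∧⁻ʳ {nbr a b} e)))
    close : deg a <ₙ m + deg a°
    close = subst (deg a <ₙ_) (+-comm (deg a°) m) (/m-equal⇒close (deg a) (deg a°) (sym (proj₂ (inBucket⁻ a°∈j))))

  -- Occupied buckets are below ⌈n/m⌉, so there are at most that many.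
  len-bound : len ≤ suc ((n ∸ 1) / m)
  len-bound = countBelow-bounded occupied n (suc ((n ∸ 1) / m)) bounded
    where
    bounded : ∀ j → j <ₙ n → occupied j ≡ true → j <ₙ suc ((n ∸ 1) / m)
    bounded j _ occ with anyB⁻ (inBucket j) occ
    ... | a , a∈j = s≤s (subst (_≤ (n ∸ 1) / m) (proj₂ (inBucket⁻ a∈j)) (/-monoˡ-≤ m deg≤n-1))
      where
      deg≤n-1 : deg a ≤ n ∸ 1
      deg≤n-1 = <⇒≤pred (deg<n a (proj₁ (inBucket⁻ a∈j)))

  adj' : Fin n → Fin n → Bool
  adj' u v = if inA u ∧ inB v then (ρ v ≤ᵇ μ u) else (if inB u ∧ inA v then (ρ u ≤ᵇ μ v) else adj G u v)

  adj'-AB : ∀ {u v} → inA u ≡ true → inB v ≡ true → adj' u v ≡ (ρ v ≤ᵇ μ u)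
  adj'-AB {u} {v} u∈A v∈B with inA u ∧ inB v | ∧⁺ u∈A v∈B
  ... | true | _ = refl

  adj'-BA : ∀ {u v} → inB u ≡ true → inA v ≡ true → adj' u v ≡ (ρ u ≤ᵇ μ v)
  adj'-BA {u} {v} u∈B v∈A with inA u ∧ inB v | cong (_∧ inB v) (B⇒¬A u∈B)
  ... | false | _ with inB u ∧ inA v | ∧⁺ u∈B v∈A
  ...   | true | _ = refl

  adj'-other : ∀ {u v} → (inA u ∧ inB v) ≡ false → (inB u ∧ inA v) ≡ false → adj' u v ≡ adj G u v
  adj'-other {u} {v} e1 e2 rewrite e1 | e2 = refl

  adj'-sym : ∀ u v → adj' u v ≡ adj' v u
  adj'-sym u v with bool-cases (inA u ∧ inB v) | bool-cases (inB u ∧ inA v)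
  ... | inj₁ e | _ = trans (adj'-AB (∧⁻ˡ e) (∧⁻ʳ {inA u} e)) (sym (adj'-BA (∧⁻ʳ {inA u} e) (∧⁻ˡ e)))
  ... | inj₂ _ | inj₁ e = trans (adj'-BA (∧⁻ˡ e) (∧⁻ʳ {inB u} e)) (sym (adj'-AB (∧⁻ʳ {inB u} e) (∧⁻ˡ e)))
  ... | inj₂ e1 | inj₂ e2 = trans (adj'-other e1 e2)
                              (trans (Graph.sym G u v) (sym (adj'-other (trans (∧-comm (inA v) (inB u)) e2) (trans (∧-comm (inB v) (inA u)) e1))))

  not-A-and-B : ∀ u → (inA u ∧ inB u) ≡ false
  not-A-and-B u with bool-cases (inA u)
  ... | inj₁ x rewrite x | A⇒¬B x = refl
  ... | inj₂ x rewrite x = refl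

  G' : Graph n
  G' = record { adj = adj' ; sym = adj'-sym
              ; irrefl = λ u → trans (adj'-other (not-A-and-B u) (trans (∧-comm (inB u) (inA u)) (not-A-and-B u))) (Graph.irrefl G u) }

  adj'⇒ρ≤μ : ∀ {a b} → inA a ≡ true → inB b ≡ true → adj' a b ≡ true → ρ b ≤ μ a
  adj'⇒ρ≤μ a∈A b∈B e = ≤ᵇ-true⇒≤ (trans (sym (adj'-AB a∈A b∈B)) e)

  ρ≤μ⇒adj' : ∀ {a b} → inA a ≡ true → inB b ≡ true → ρ b ≤ μ a → adj' a b ≡ true
  ρ≤μ⇒adj' a∈A b∈B le = trans (adj'-AB a∈A b∈B) (≤⇒≤ᵇ-true le)

  adj'⇒fullyAdj : ∀ {a b} → inA a ≡ true → inB b ≡ true → adj' a b ≡ true → fullyAdj (bucket a) b ≡ true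
  adj'⇒fullyAdj {a} {b} a∈A b∈B e with bool-cases (fullyAdj (bucket a) b)
  ... | inj₁ full = full
  ... | inj₂ partial = ⊥-elim (<⇒≱ (partial⇒μ<ρ a b a∈A b∈B partial) (adj'⇒ρ≤μ a∈A b∈B e))

  adj'⇒adj : ∀ u v → adj' u v ≡ true → adj G u v ≡ true
  adj'⇒adj u v e with bool-cases (inA u ∧ inB v) | bool-cases (inB u ∧ inA v)
  ... | inj₁ c | _ = fullyAdj⁻ (adj'⇒fullyAdj (∧⁻ˡ c) (∧⁻ʳ {inA u} c) e) (inBucket⁺ (∧⁻ˡ c))
  ... | inj₂ _ | inj₁ c = adj-sym G u v (fullyAdj⁻ (adj'⇒fullyAdj (∧⁻ʳ {inB u} c) (∧⁻ˡ c) (trans (adj'-sym v u) e)) (inBucket⁺ (∧⁻ʳ {inB u} c)))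
  ... | inj₂ e1 | inj₂ e2 = trans (sym (adj'-other e1 e2)) e

  removed⇒AB : ∀ u v → adj G u v ≡ true → adj' u v ≡ false → ((inA u ∧ inB v) ≡ true) ⊎ ((inB u ∧ inA v) ≡ true)
  removed⇒AB u v e e' with bool-cases (inA u ∧ inB v) | bool-cases (inB u ∧ inA v)
  ... | inj₁ c | _ = inj₁ c
  ... | inj₂ _ | inj₁ c = inj₂ c
  ... | inj₂ e1 | inj₂ e2 = ⊥-elim (true≢false (trans (sym e) (trans (sym (adj'-other e1 e2)) e')))

  deletes : DeletesBetween G G' C₁ C₂
  deletes = adj'⇒adj , λ u v e e' → as-subsets u v (removed⇒AB u v e e')
    where
    A⇒∈ : ∀ {u} → inA u ≡ true → u ∈ (C₁ ─ C₂)
    A⇒∈ {u} e = lookup⇒∈ (trans (lookup-─ C₁ C₂ u) e)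
    B⇒∈ : ∀ {u} → inB u ≡ true → u ∈ (C₂ ─ C₁)
    B⇒∈ {u} e = lookup⇒∈ (trans (lookup-─ C₂ C₁ u) e)
    as-subsets : ∀ u v → ((inA u ∧ inB v) ≡ true) ⊎ ((inB u ∧ inA v) ≡ true) →
                 (u ∈ (C₁ ─ C₂) × v ∈ (C₂ ─ C₁)) ⊎ (u ∈ (C₂ ─ C₁) × v ∈ (C₁ ─ C₂))
    as-subsets u v (inj₁ c) = inj₁ (A⇒∈ (∧⁻ˡ c) , B⇒∈ (∧⁻ʳ {inA u} c))
    as-subsets u v (inj₂ c) = inj₂ (B⇒∈ (∧⁻ˡ c) , A⇒∈ (∧⁻ʳ {inB u} c))

  -- Condition (1): every changed pair is an A–B pair, charged to its
  -- endpoint a ∈ A; a is charged at most count (deleted a) ≤ M times.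
  indicator : Bool → ℕ
  indicator b = if b then 1 else 0

  indicator≤1 : ∀ b → indicator b ≤ 1
  indicator≤1 true = ≤-refl
  indicator≤1 false = z≤n

  changed : Fin n → Fin n → Bool
  changed u v = adj G u v xor adj' u v

  changed⇒removed : ∀ u v → changed u v ≡ true → (adj G u v ≡ true) × (adj' u v ≡ false)
  changed⇒removed u v e with bool-cases (adj G u v) | bool-cases (adj' u v)
  ... | inj₁ e1 | inj₂ e2 = e1 , e2
  ... | inj₁ e1 | inj₁ e2 = ⊥-elim (true≢false (trans (sym e) (cong₂ _xor_ e1 e2)))
  ... | inj₂ e1 | inj₂ e2 = ⊥-elim (true≢false (trans (sym e) (cong₂ _xor_ e1 e2)))
  ... | inj₂ e1 | inj₁ e2 = ⊥-elim (true≢false (trans (sym (adj'⇒adj u v e2)) e1))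

  changed-sym : ∀ u v → changed u v ≡ changed v u
  changed-sym u v = cong₂ _xor_ (Graph.sym G u v) (adj'-sym u v)

  summand charge chargeLow chargeHigh : Fin n → Fin n → ℕ
  summand u v = if (toℕ u <ᵇ toℕ v) ∧ (adj G u v xor adj' u v) then 1 else 0
  charge u v = indicator (inA u ∧ changed u v)
  chargeLow u v = indicator ((toℕ u <ᵇ toℕ v) ∧ (inA u ∧ changed u v))
  chargeHigh u v = indicator ((toℕ v <ᵇ toℕ u) ∧ (inA u ∧ changed u v))

  summand≤charges : ∀ u v → summand u v ≤ chargeLow u v + chargeHigh v u
  summand≤charges u v with bool-cases ((toℕ u <ᵇ toℕ v) ∧ changed u v)
  ... | inj₂ x = subst (_≤ chargeLow u v + chargeHigh v u) (sym (cong indicator x)) z≤n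
  ... | inj₁ x with changed⇒removed u v (∧⁻ʳ {toℕ u <ᵇ toℕ v} x)
  ...   | e , e' with removed⇒AB u v e e'
  ...     | inj₁ c = ≤-trans (indicator≤1 _)
                       (subst (_≤ chargeLow u v + chargeHigh v u) (cong indicator (∧⁺ (∧⁻ˡ {toℕ u <ᵇ toℕ v} x) (∧⁺ (∧⁻ˡ c) (∧⁻ʳ {toℕ u <ᵇ toℕ v} x))))
                         (m≤m+n (chargeLow u v) (chargeHigh v u)))
  ...     | inj₂ c = ≤-trans (indicator≤1 _)
                       (subst (_≤ chargeLow u v + chargeHigh v u) (cong indicator (∧⁺ (∧⁻ˡ {toℕ u <ᵇ toℕ v} x) (∧⁺ (∧⁻ʳ {inB u} c) (trans (changed-sym v u) (∧⁻ʳ {toℕ u <ᵇ toℕ v} x)))))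
                         (m≤n+m (chargeHigh v u) (chargeLow u v)))

  low+high≤charge : ∀ u v → chargeLow u v + chargeHigh u v ≤ charge u v
  low+high≤charge u v with bool-cases (inA u ∧ changed u v)
  ... | inj₂ c rewrite c = ≤-reflexive (cong₂ _+_ (cong indicator (∧-zeroʳ (toℕ u <ᵇ toℕ v))) (cong indicator (∧-zeroʳ (toℕ v <ᵇ toℕ u))))
  ... | inj₁ c rewrite c with bool-cases (toℕ u <ᵇ toℕ v)
  ...   | inj₁ l rewrite l | <⇒flipped-<ᵇ-false (<ᵇ-true⇒< {toℕ u} {toℕ v} l) = ≤-refl
  ...   | inj₂ l rewrite l = indicator≤1 _

  charges-of-a : ∀ u → sumF (charge u) ≤ M
  charges-of-a u rewrite sumF-indicator (λ v → inA u ∧ changed u v) with bool-cases (inA u)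
  ... | inj₂ x rewrite x = subst (_≤ M) (sym (count-false {n})) z≤n
  ... | inj₁ u∈A = ≤-trans (count-mono _ (deleted u) charged⇒deleted) (deleted-bound u u∈A)
    where
    charged⇒deleted : (λ v → inA u ∧ changed u v) ⇒ᵇ deleted u
    charged⇒deleted v e with changed⇒removed u v (∧⁻ʳ {inA u} e)
    ... | e1 , e2 with removed⇒AB u v e1 e2
    ...   | inj₁ c = ∧⁺ (∧⁺ (∧⁻ʳ {inA u} c) e1) (false⇒not-true (≢true⇒false (λ full → true≢false (trans (sym (adj'-fullyAdj full)) e2))))
      where adj'-fullyAdj : fullyAdj (bucket u) v ≡ true → adj' u v ≡ true
            adj'-fullyAdj full = ρ≤μ⇒adj' u∈A (∧⁻ʳ {inA u} c) (fullyAdj⇒ρ≤μ u v u∈A (∧⁻ʳ {inA u} c) full)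
    ...   | inj₂ c = ⊥-elim (true≢false (trans (sym (∧⁻ˡ c)) (A⇒¬B u∈A)))

  edgeDiff-bound : edgeDiff G G' ≤ n * M
  edgeDiff-bound = begin
      edgeDiff G G'
        ≡⟨ sum-tabulate (λ x → x) (λ u → sum (L.map (summand u) (L.allFin n))) ⟩
      sumF (λ u → sum (L.map (summand u) (L.allFin n)))
        ≡⟨ sumF-cong _ _ (λ u → sum-tabulate (λ x → x) (summand u)) ⟩
      sumF (λ u → sumF (summand u))
        ≤⟨ sumF-mono _ _ (λ u → sumF-mono _ _ (λ v → summand≤charges u v)) ⟩
      sumF (λ u → sumF (λ v → chargeLow u v + chargeHigh v u))
        ≡⟨ sumF-cong _ _ (λ u → sumF-+ (chargeLow u) (λ v → chargeHigh v u)) ⟩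
      sumF (λ u → sumF (chargeLow u) + sumF (λ v → chargeHigh v u))
        ≡⟨ sumF-+ (λ u → sumF (chargeLow u)) (λ u → sumF (λ v → chargeHigh v u)) ⟩
      sumF (λ u → sumF (chargeLow u)) + sumF (λ u → sumF (λ v → chargeHigh v u))
        ≡⟨ cong (sumF (λ u → sumF (chargeLow u)) +_) (sumF-swap (λ u v → chargeHigh v u)) ⟩
      sumF (λ u → sumF (chargeLow u)) + sumF (λ v → sumF (λ u → chargeHigh v u))
        ≡⟨ sumF-+ (λ u → sumF (chargeLow u)) (λ u → sumF (chargeHigh u)) ⟨
      sumF (λ u → sumF (chargeLow u) + sumF (chargeHigh u))
        ≡⟨ sumF-cong _ _ (λ u → sumF-+ (chargeLow u) (chargeHigh u)) ⟨
      sumF (λ u → sumF (λ v → chargeLow u v + chargeHigh u v))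
        ≤⟨ sumF-mono _ _ (λ u → sumF-mono _ _ (λ v → low+high≤charge u v)) ⟩
      sumF (λ u → sumF (charge u))
        ≤⟨ sumF-mono _ _ charges-of-a ⟩
      sumF {n} (λ _ → M)
        ≡⟨ sumF-const {n} M ⟩
      n * M ∎
    where open ≤-Reasoning

  -- Inside S, pairs other than A–B pairs lie together in C₁ or in C₂, so
  -- they are adjacent in G and hence in G'.
  adjacent-in-S : ∀ {u v} → u ∈ S → v ∈ S → u ≢ v → (inA u ∧ inB v) ≡ false → (inB u ∧ inA v) ≡ false → adj' u v ≡ true
  adjacent-in-S {u} {v} u∈S v∈S u≢v e1 e2 = trans (adj'-other e1 e2) (by-parts (part u∈S) (part v∈S))
    where
    by-parts : Part u → Part v → adj G u v ≡ true
    by-parts (partI x _) (partI x' _) = clique₁ x x' u≢v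
    by-parts (partI x _) (partA x') = clique₁ x (A⇒c1 x') u≢v
    by-parts (partI _ y) (partB x') = clique₂ y (B⇒c2 x') u≢v
    by-parts (partA x) (partI x' _) = clique₁ (A⇒c1 x) x' u≢v
    by-parts (partA x) (partA x') = clique₁ (A⇒c1 x) (A⇒c1 x') u≢v
    by-parts (partA x) (partB x') = ⊥-elim (true≢false (trans (sym (∧⁺ x x')) e1))
    by-parts (partB x) (partI _ y') = clique₂ (B⇒c2 x) y' u≢v
    by-parts (partB x) (partA x') = ⊥-elim (true≢false (trans (sym (∧⁺ x x')) e2))
    by-parts (partB x) (partB x') = clique₂ (B⇒c2 x) (B⇒c2 x') u≢v

  adjacent-unless-cut : ∀ {u v} → u ∈ S → v ∈ S → u ≢ v →
                        (inA u ≡ true → inB v ≡ true → ρ v ≤ μ u) → (inB u ≡ true → inA v ≡ true → ρ u ≤ μ v) → adj' u v ≡ true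
  adjacent-unless-cut {u} {v} u∈S v∈S u≢v AB BA with bool-cases (inA u ∧ inB v) | bool-cases (inB u ∧ inA v)
  ... | inj₁ c | _ = ρ≤μ⇒adj' (∧⁻ˡ c) (∧⁻ʳ {inA u} c) (AB (∧⁻ˡ c) (∧⁻ʳ {inA u} c))
  ... | inj₂ _ | inj₁ c = trans (adj'-sym u v) (ρ≤μ⇒adj' (∧⁻ʳ {inB u} c) (∧⁻ˡ c) (BA (∧⁻ˡ c) (∧⁻ʳ {inB u} c)))
  ... | inj₂ e1 | inj₂ e2 = adjacent-in-S u∈S v∈S u≢v e1 e2

  Opposite : Fin n → Fin n → Set
  Opposite x y = ((inA x ≡ true) × (inB y ≡ true)) ⊎ ((inB x ≡ true) × (inA y ≡ true))

  non-adjacent⇒opposite : ∀ {x y} → x ∈ S → y ∈ S → x ≢ y → adj' x y ≡ false → Opposite x y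
  non-adjacent⇒opposite {x} {y} x∈S y∈S x≢y e with bool-cases (inA x ∧ inB y) | bool-cases (inB x ∧ inA y)
  ... | inj₁ c | _ = inj₁ (∧⁻ˡ c , ∧⁻ʳ {inA x} c)
  ... | inj₂ _ | inj₁ c = inj₂ (∧⁻ˡ c , ∧⁻ʳ {inB x} c)
  ... | inj₂ e1 | inj₂ e2 = ⊥-elim (true≢false (trans (sym (adjacent-in-S x∈S y∈S x≢y e1 e2)) e))

  opposite⇒A-differs : ∀ {x y} → Opposite x y → inA x ≡ not (inA y)
  opposite⇒A-differs (inj₁ (a , b)) = trans a (sym (cong not (B⇒¬A b)))
  opposite⇒A-differs (inj₂ (b , a)) = trans (B⇒¬A b) (sym (cong not a))

  -- G' has no crossed pair: ρ b ≤ μ a < ρ b' ≤ μ a' < ρ b is impossible.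
  no-crossed-pair' : ∀ a a' b b' → inA a ≡ true → inA a' ≡ true → inB b ≡ true → inB b' ≡ true →
                     adj' a b ≡ true → adj' a' b' ≡ true → adj' a b' ≡ false → adj' a' b ≡ false → ⊥
  no-crossed-pair' a a' b b' a∈A a'∈A b∈B b'∈B ab a'b' ab' a'b =
    <-irrefl refl (≤-<-trans (adj'⇒ρ≤μ a∈A b∈B ab)
                    (<-trans (≤ᵇ-false⇒> (trans (sym (adj'-AB a∈A b'∈B)) ab'))
                      (≤-<-trans (adj'⇒ρ≤μ a'∈A b'∈B a'b') (≤ᵇ-false⇒> (trans (sym (adj'-AB a'∈A b∈B)) a'b)))))

  cycle-edge : ∀ {k} (f : Fin k → Fin n) → InducedCycleIn G' S k f → ∀ i j → does (cycAdj? i j) ≡ true → adj' (f i) (f j) ≡ true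
  cycle-edge f (_ , _ , iff) i j c = Equivalence.from (iff i j) (does-true⇒ (cycAdj? i j) c)

  cycle-non-edge : ∀ {k} (f : Fin k → Fin n) → InducedCycleIn G' S k f → ∀ i j → does (cycAdj? i j) ≡ false → adj' (f i) (f j) ≡ false
  cycle-non-edge f (_ , _ , iff) i j nc = ≢true⇒false (λ e → does-false⇒ (cycAdj? i j) nc (Equivalence.to (iff i j) e))

  cycle-chord : ∀ {k} (f : Fin k → Fin n) → InducedCycleIn G' S k f → ∀ i j → i ≢ j → does (cycAdj? i j) ≡ false → Opposite (f i) (f j)
  cycle-chord f cyc@(inj , f∈S , _) i j i≢j nc = non-adjacent⇒opposite (f∈S i) (f∈S j) (λ e → i≢j (inj e)) (cycle-non-edge f cyc i j nc)

  -- An induced 4-cycle would contain a crossed pair.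
  no-induced-square : (f : Fin 4 → Fin n) → ¬ InducedCycleIn G' S 4 f
  no-induced-square f cyc = crossed (cycle-chord f cyc (# 0) (# 2) (λ ()) refl) (cycle-chord f cyc (# 1) (# 3) (λ ()) refl)
    where
    E : ∀ i j → does (cycAdj? i j) ≡ true → adj' (f i) (f j) ≡ true
    E = cycle-edge f cyc
    N : ∀ i j → does (cycAdj? i j) ≡ false → adj' (f i) (f j) ≡ false
    N = cycle-non-edge f cyc
    crossed : Opposite (f (# 0)) (f (# 2)) → Opposite (f (# 1)) (f (# 3)) → ⊥
    crossed (inj₁ (a0 , b2)) (inj₁ (a1 , b3)) = no-crossed-pair' _ _ _ _ a1 a0 b2 b3 (E (# 1) (# 2) refl) (E (# 0) (# 3) refl) (N (# 1) (# 3) refl) (N (# 0) (# 2) refl)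
    crossed (inj₁ (a0 , b2)) (inj₂ (b1 , a3)) = no-crossed-pair' _ _ _ _ a0 a3 b1 b2 (E (# 0) (# 1) refl) (E (# 3) (# 2) refl) (N (# 0) (# 2) refl) (N (# 3) (# 1) refl)
    crossed (inj₂ (b0 , a2)) (inj₁ (a1 , b3)) = no-crossed-pair' _ _ _ _ a1 a2 b0 b3 (E (# 1) (# 0) refl) (E (# 2) (# 3) refl) (N (# 1) (# 3) refl) (N (# 2) (# 0) refl)
    crossed (inj₂ (b0 , a2)) (inj₂ (b1 , a3)) = no-crossed-pair' _ _ _ _ a2 a3 b1 b0 (E (# 2) (# 1) refl) (E (# 3) (# 0) refl) (N (# 2) (# 0) refl) (N (# 3) (# 1) refl)

  -- In an induced cycle of length ≥ 5 the chords 02, 24, 03, 13, 14 all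
  -- join opposite sides, which no-odd-alternation forbids.
  no-long-induced-cycle : ∀ k (f : Fin (5 + k) → Fin n) → ¬ InducedCycleIn G' S (5 + k) f
  no-long-induced-cycle k f cyc =
    no-odd-alternation _ _ _ _ _ (opposite (# 0) (# 2) (λ ()) refl) (opposite (# 2) (# 4) (λ ()) refl) (opposite (# 0) (# 3) (λ ()) refl)
                                 (opposite (# 1) (# 3) (λ ()) refl) (opposite (# 1) (# 4) (λ ()) refl)
    where
    opposite : ∀ i j → i ≢ j → does (cycAdj? i j) ≡ false → inA (f i) ≡ not (inA (f j))
    opposite i j i≢j nc = opposite⇒A-differs (cycle-chord f cyc i j i≢j nc)

  chordal' : ChordalOn G' S
  chordal' zero ()
  chordal' (suc zero) (s≤s ())
  chordal' (suc (suc zero)) (s≤s (s≤s ()))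
  chordal' (suc (suc (suc zero))) (s≤s (s≤s (s≤s ())))
  chordal' (suc (suc (suc (suc zero)))) _ = no-induced-square
  chordal' (suc (suc (suc (suc (suc k))))) _ = no-long-induced-cycle k

  inQ : ℕ → Fin n → Bool
  inQ t u = inI u ∨ ((inA u ∧ (t ≤ᵇ μ u)) ∨ (inB u ∧ (ρ u ≤ᵇ t)))

  inQ-A : ∀ {t u} → inA u ≡ true → inQ t u ≡ (t ≤ᵇ μ u)
  inQ-A {t} {u} e = trans (cong₂ _∨_ A¬I (cong₂ (λ x y → (x ∧ (t ≤ᵇ μ u)) ∨ (y ∧ (ρ u ≤ᵇ t))) e (A⇒¬B e))) (∨-identityʳ _)
    where A¬I : inI u ≡ false
          A¬I = trans (cong (c1 u ∧_) (A⇒¬c2 e)) (∧-zeroʳ (c1 u))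

  inQ-B : ∀ {t u} → inB u ≡ true → inQ t u ≡ (ρ u ≤ᵇ t)
  inQ-B {t} {u} e = cong₂ _∨_ (cong (_∧ c2 u) (B⇒¬c1 e)) (cong₂ (λ x y → (x ∧ (t ≤ᵇ μ u)) ∨ (y ∧ (ρ u ≤ᵇ t))) (B⇒¬A e) e)

  inQ-I : ∀ {t u} → c1 u ≡ true → c2 u ≡ true → inQ t u ≡ true
  inQ-I x y = ∨⁺ˡ _ (∧⁺ x y)

  inQ-outside : ∀ {t u} → c1 u ≡ false → c2 u ≡ false → inQ t u ≡ false
  inQ-outside x y rewrite x | y = refl

  inQ⇒S : ∀ {t u} → inQ t u ≡ true → u ∈ S
  inQ⇒S {t} {u} e = lookup⇒∈ (trans (lookup-∪ C₁ C₂ u) (by-parts (∨⁻ e)))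
    where
    by-parts : (inI u ≡ true) ⊎ ((inA u ∧ (t ≤ᵇ μ u)) ∨ (inB u ∧ (ρ u ≤ᵇ t)) ≡ true) → c1 u ∨ c2 u ≡ true
    by-parts (inj₁ x) = ∨⁺ˡ (c2 u) (∧⁻ˡ {c1 u} x)
    by-parts (inj₂ x) with ∨⁻ x
    ... | inj₁ y = ∨⁺ˡ (c2 u) (A⇒c1 (∧⁻ˡ {inA u} y))
    ... | inj₂ y = ∨⁺ʳ (c1 u) (B⇒c2 (∧⁻ˡ {inB u} y))

  Q : ℕ → Subset n
  Q t = tabulate (inQ t)

  ∈Q⁻ : ∀ {t u} → u ∈ Q t → inQ t u ≡ true
  ∈Q⁻ {t} {u} u∈Q = trans (sym (lookup∘tabulate (inQ t) u)) (∈⇒lookup u∈Q)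

  ∈Q⁺ : ∀ {t u} → inQ t u ≡ true → u ∈ Q t
  ∈Q⁺ {t} {u} e = lookup⇒∈ (trans (lookup∘tabulate (inQ t) u) e)

  Q-clique : ∀ t → IsCliqueIn G' S (Q t)
  Q-clique t = (λ u∈Q → inQ⇒S (∈Q⁻ u∈Q)) , λ u v u∈Q v∈Q u≢v →
    adjacent-unless-cut (inQ⇒S (∈Q⁻ u∈Q)) (inQ⇒S (∈Q⁻ v∈Q)) u≢v
      (λ a b → ≤-trans (ρ≤t v∈Q b) (t≤μ u∈Q a)) (λ b a → ≤-trans (ρ≤t u∈Q b) (t≤μ v∈Q a))
    where
    t≤μ : ∀ {u} → u ∈ Q t → inA u ≡ true → t ≤ μ u
    t≤μ u∈Q a = ≤ᵇ-true⇒≤ (trans (sym (inQ-A a)) (∈Q⁻ u∈Q))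
    ρ≤t : ∀ {u} → u ∈ Q t → inB u ≡ true → ρ u ≤ t
    ρ≤t u∈Q b = ≤ᵇ-true⇒≤ (trans (sym (inQ-B b)) (∈Q⁻ u∈Q))

  -- A vertex of A adjacent in G' to the B-part of Q t belongs to Q t, since
  -- some b ∈ B has ρ b = t.  Symmetrically for B, using some a with μ a = t.
  A-joining-Q : ∀ t → t ≤ len → ∀ a → inA a ≡ true → (∀ b → inB b ≡ true → inQ t b ≡ true → adj' a b ≡ true) → t ≤ μ a
  A-joining-Q zero _ a _ _ = z≤n
  A-joining-Q (suc s) s<len a a∈A joins with ρ-onto s s<len
  ... | b , b∈B , ρb≡t = subst (_≤ μ a) ρb≡t (adj'⇒ρ≤μ a∈A b∈B (joins b b∈B (trans (inQ-B b∈B) (≤⇒≤ᵇ-true (≤-reflexive ρb≡t)))))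

  B-joining-Q : ∀ t b → inB b ≡ true → (∀ a → inA a ≡ true → inQ t a ≡ true → adj' a b ≡ true) → ρ b ≤ t
  B-joining-Q t b b∈B joins with ρ b ≤? t
  ... | yes le = le
  ... | no nle with μ-onto t (<-≤-trans (≰⇒> nle) (ρ≤len b))
  ...   | a , a∈A , μa≡t = ⊥-elim (nle (subst (ρ b ≤_) μa≡t (adj'⇒ρ≤μ a∈A b∈B (joins a a∈A (trans (inQ-A a∈A) (≤⇒≤ᵇ-true (≤-reflexive (sym μa≡t))))))))

  Q-maximal : ∀ t → t ≤ len → IsMaximalCliqueIn G' S (Q t)
  Q-maximal t t≤len = Q-clique t , maximal
    where
    maximal : ∀ D → IsCliqueIn G' S D → Q t ⊆ D → D ⊆ Q t
    maximal D (D⊆S , clD) Q⊆D {x} x∈D with part (D⊆S x∈D)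
    ... | partI a b = ∈Q⁺ (inQ-I a b)
    ... | partA a = ∈Q⁺ (trans (inQ-A a) (≤⇒≤ᵇ-true (A-joining-Q t t≤len x a λ b b∈B b∈Q →
                      clD x b x∈D (Q⊆D (∈Q⁺ b∈Q)) (A≢B a b∈B))))
    ... | partB b = ∈Q⁺ (trans (inQ-B b) (≤⇒≤ᵇ-true (B-joining-Q t x b λ a a∈A a∈Q →
                      clD a x (Q⊆D (∈Q⁺ a∈Q)) x∈D (A≢B a∈A b))))

  -- The Q t are distinct: a vertex b with ρ b = t is in Q t but not in Q s, s < t.
  Q-distinct : ∀ s t → s <ₙ t → t ≤ len → Q s ≢ Q t
  Q-distinct s (suc t') s<t t≤len Qs≡Qt with ρ-onto t' t≤len
  ... | b , b∈B , ρb≡t = true≢false (trans (sym b∈Qt) (trans (cong (λ X → lookup X b) (sym Qs≡Qt)) b∉Qs))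
    where
    b∈Qt : lookup (Q (suc t')) b ≡ true
    b∈Qt = trans (lookup∘tabulate _ b) (trans (inQ-B b∈B) (≤⇒≤ᵇ-true (≤-reflexive ρb≡t)))
    b∉Qs : lookup (Q s) b ≡ false
    b∉Qs = trans (lookup∘tabulate _ b) (trans (inQ-B b∈B) (>⇒≤ᵇ-false (subst (s <ₙ_) (sym ρb≡t) s<t)))

  path : Fin (suc len) → Subset n
  path i = Q (toℕ i)

  path-injective : Injective _≡_ _≡_ path
  path-injective {i} {j} eq with <-cmp (toℕ i) (toℕ j)
  ... | tri< lt _ _ = ⊥-elim (Q-distinct (toℕ i) (toℕ j) lt (≤-pred (toℕ<n j)) eq)
  ... | tri≈ _ i≡j _ = toℕ-injective i≡j
  ... | tri> _ _ gt = ⊥-elim (Q-distinct (toℕ j) (toℕ i) gt (≤-pred (toℕ<n i)) (sym eq))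

  path-maximal : ∀ i → IsMaximalCliqueIn G' S (path i)
  path-maximal i = Q-maximal (toℕ i) (≤-pred (toℕ<n i))

  -- Every maximal clique C of G'[S] is Q t for t the largest ρ-value on C ∩ B.
  path-covers : ∀ C → IsMaximalCliqueIn G' S C → ∃ λ i → path i ≡ C
  path-covers C ((C⊆S , clC) , maxC) with maxF (λ u → lookup C u ∧ inB u) ρ
  ... | t , ρ≤t , t-attained = fromℕ< (s≤s t≤len) , trans (cong Q (toℕ-fromℕ< (s≤s t≤len))) (⊆-antisym (maxC (Q t) (Q-clique t) C⊆Q) C⊆Q)
    where
    t≤len : t ≤ len
    t≤len = [ (λ t≡0 → subst (_≤ len) (sym t≡0) z≤n) , (λ { (z , _ , ρz≡t) → subst (_≤ len) ρz≡t (ρ≤len z) }) ]′ t-attained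
    t≤μ : ∀ a → inA a ≡ true → a ∈ C → t ≤ μ a
    t≤μ a a∈A a∈C = [ (λ t≡0 → subst (_≤ μ a) (sym t≡0) z≤n) , (λ { (z , z∈C∩B , ρz≡t) → subst (_≤ μ a) ρz≡t
                        (adj'⇒ρ≤μ a∈A (∧⁻ʳ {lookup C z} z∈C∩B) (clC a z a∈C (lookup⇒∈ (∧⁻ˡ z∈C∩B)) (A≢B a∈A (∧⁻ʳ {lookup C z} z∈C∩B)))) }) ]′ t-attained
    C⊆Q : C ⊆ Q t
    C⊆Q {x} x∈C with part (C⊆S x∈C)
    ... | partI a b = ∈Q⁺ (inQ-I a b)
    ... | partB b = ∈Q⁺ (trans (inQ-B b) (≤⇒≤ᵇ-true (ρ≤t x (∧⁺ (∈⇒lookup x∈C) b))))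
    ... | partA a = ∈Q⁺ (trans (inQ-A a) (≤⇒≤ᵇ-true (t≤μ x a x∈C)))

  path-interval : ∀ i j l → toℕ i ≤ toℕ j → toℕ j ≤ toℕ l → (path i ∩ path l) ⊆ path j
  path-interval i j l i≤j j≤l {x} x∈∩ with ∧⁻ˡ {lookup (path i) x} (trans (sym (lookup-∩ (path i) (path l) x)) (∈⇒lookup x∈∩))
                                        | ∧⁻ʳ {lookup (path i) x} (trans (sym (lookup-∩ (path i) (path l) x)) (∈⇒lookup x∈∩))
  ... | x∈Qi | x∈Ql with part (inQ⇒S (∈Q⁻ {toℕ i} (lookup⇒∈ x∈Qi)))
  ...   | partI a b = ∈Q⁺ (inQ-I a b)
  ...   | partA a = ∈Q⁺ (trans (inQ-A a) (≤⇒≤ᵇ-true (≤-trans j≤l (≤ᵇ-true⇒≤ {toℕ l} {μ x} (trans (sym (inQ-A a)) (∈Q⁻ {toℕ l} (lookup⇒∈ x∈Ql)))))))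
  ...   | partB b = ∈Q⁺ (trans (inQ-B b) (≤⇒≤ᵇ-true (≤-trans (≤ᵇ-true⇒≤ {ρ x} {toℕ i} (trans (sym (inQ-B b)) (∈Q⁻ {toℕ i} (lookup⇒∈ x∈Qi)))) i≤j)))

  -- The path starts at C₁ (every b has ρ b ≥ 1) and ends at C₂ (every a has μ a < len).
  path-first : path zero ≡ C₁
  path-first = subset-ext (Q 0) C₁ λ u → trans (lookup∘tabulate _ u) (by-parts u (bool-cases (c1 u)) (bool-cases (c2 u)))
    where
    by-parts : ∀ u → (c1 u ≡ true) ⊎ (c1 u ≡ false) → (c2 u ≡ true) ⊎ (c2 u ≡ false) → inQ 0 u ≡ c1 u
    by-parts u (inj₁ x) (inj₁ y) = trans (inQ-I x y) (sym x)
    by-parts u (inj₁ x) (inj₂ y) = trans (inQ-A (∧⁺ x (false⇒not-true y))) (sym x)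
    by-parts u (inj₂ x) (inj₁ y) = trans (inQ-B u∈B) (trans (>⇒≤ᵇ-false (ρ-positive u u∈B)) (sym x))
      where u∈B = ∧⁺ y (false⇒not-true x)
    by-parts u (inj₂ x) (inj₂ y) = trans (inQ-outside x y) (sym x)

  path-last : path (fromℕ len) ≡ C₂
  path-last = trans (cong Q (toℕ-fromℕ len)) (subset-ext (Q len) C₂ λ u → trans (lookup∘tabulate _ u) (by-parts u (bool-cases (c1 u)) (bool-cases (c2 u))))
    where
    by-parts : ∀ u → (c1 u ≡ true) ⊎ (c1 u ≡ false) → (c2 u ≡ true) ⊎ (c2 u ≡ false) → inQ len u ≡ c2 u
    by-parts u (inj₁ x) (inj₁ y) = trans (inQ-I x y) (sym y)
    by-parts u (inj₁ x) (inj₂ y) = trans (inQ-A u∈A) (trans (>⇒≤ᵇ-false (μ<len u u∈A)) (sym y))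
      where u∈A = ∧⁺ x (false⇒not-true y)
    by-parts u (inj₂ x) (inj₁ y) = trans (inQ-B (∧⁺ y (false⇒not-true x))) (trans (≤⇒≤ᵇ-true (ρ≤len u)) (sym y))
    by-parts u (inj₂ x) (inj₂ y) = trans (inQ-outside x y) (sym y)

  -- For a clique C ⊆ S of G let a₀ be a vertex of C ∩ A of
  -- least rank τ = μ a₀ (τ = len if C ∩ A is empty).  Every b ∈ C ∩ B with
  -- ρ b > τ is a G-neighbour of a₀ that is not fully adjacent to its
  -- bucket, i.e. one of the at most M edges deleted at a₀.
  threshold : ∀ C → IsClique G C → Σ ℕ λ τ → (∀ a → lookup C a ≡ true → inA a ≡ true → τ ≤ μ a) ×
              (Σ (Fin n → Bool) λ h → (count h ≤ M) × (∀ b → lookup C b ≡ true → inB b ≡ true → τ <ₙ ρ b → h b ≡ true))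
  threshold C clC with search (λ u → lookup C u ∧ inA u)
  ... | inj₂ none = len , (λ a c a∈A → ⊥-elim (true≢false (trans (sym (∧⁺ c a∈A)) (none a)))) ,
                    (λ _ → false) , subst (_≤ M) (sym (count-false {n})) z≤n , λ b _ _ τ<ρ → ⊥-elim (<⇒≱ τ<ρ (ρ≤len b))
  ... | inj₁ (a₁ , e₁) with argmin (λ u → lookup C u ∧ inA u) μ a₁ e₁
  ...   | a₀ , e₀ , a₀min = μ a₀ , (λ a c a∈A → a₀min a (∧⁺ c a∈A)) , deleted a₀ , deleted-bound a₀ a₀∈A , deleted-at-a₀
    where
    a₀∈A : inA a₀ ≡ true
    a₀∈A = ∧⁻ʳ {lookup C a₀} e₀
    deleted-at-a₀ : ∀ b → lookup C b ≡ true → inB b ≡ true → μ a₀ <ₙ ρ b → deleted a₀ b ≡ true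
    deleted-at-a₀ b cb b∈B lt = ∧⁺ (∧⁺ b∈B (clC a₀ b (lookup⇒∈ (∧⁻ˡ e₀)) (lookup⇒∈ cb) (A≢B a₀∈A b∈B)))
                                    (false⇒not-true (≢true⇒false (λ full → <⇒≱ lt (fullyAdj⇒ρ≤μ a₀ b a₀∈A b∈B full))))

  kept : Subset n → ℕ → Fin n → Bool
  kept C τ u = lookup C u ∧ (not (inB u) ∨ (ρ u ≤ᵇ τ))

  kept-clique : ∀ C τ → C ⊆ S → (∀ a → lookup C a ≡ true → inA a ≡ true → τ ≤ μ a) → CliqueB G' (kept C τ)
  kept-clique C τ C⊆S τ≤μ u v ku kv u≢v =
    adjacent-unless-cut (C⊆S (lookup⇒∈ cu)) (C⊆S (lookup⇒∈ cv)) u≢v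
      (λ a b → ≤-trans (ρ≤τ kv b) (τ≤μ u cu a)) (λ b a → ≤-trans (ρ≤τ ku b) (τ≤μ v cv a))
    where
    cu = ∧⁻ˡ {lookup C u} ku
    cv = ∧⁻ˡ {lookup C v} kv
    ρ≤τ : ∀ {w} → kept C τ w ≡ true → inB w ≡ true → ρ w ≤ τ
    ρ≤τ {w} kw w∈B with ∨⁻ (∧⁻ʳ {lookup C w} kw)
    ... | inj₁ x = ⊥-elim (true≢false (trans (sym x) (cong not w∈B)))
    ... | inj₂ x = ≤ᵇ-true⇒≤ x

  not-kept : ∀ C τ b → lookup C b ≡ true → kept C τ b ≡ false → (inB b ≡ true) × (τ <ₙ ρ b)
  not-kept C τ b cb e with ∨-false⁻ {not (inB b)} (∧-false⁻ (lookup C b) cb e)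
  ... | ¬¬B , ρ>τ = not-false⇒true ¬¬B , ≤ᵇ-false⇒> ρ>τ

  -- Extend the kept part of C to a maximal clique C' of G'; C ∖ C' consists
  -- of non-kept vertices, which are among the at most M deleted at a₀.
  condition3 : ∀ C → IsClique G C → C ⊆ S → Σ (Subset n) λ C' → IsMaximalClique G' C' × (∣ C ─ C' ∣ ≤ M)
  condition3 C clC C⊆S with threshold C clC
  ... | τ , τ≤μ , h , h≤M , h-covers with extend G' (kept C τ) (kept-clique C τ C⊆S τ≤μ)
  ...   | C' , maxC' , kept⊆C' = C' , maxC' , subst (_≤ M) (sym (∣∣≡count (C ─ C'))) (≤-trans (count-mono _ h lost⊆h) h≤M)
    where
    lost⊆h : lookup (C ─ C') ⇒ᵇ h
    lost⊆h b e = h-covers b cb b∈B τ<ρ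
      where
      e' = trans (sym (lookup-─ C C' b)) e
      cb : lookup C b ≡ true
      cb = ∧⁻ˡ {lookup C b} e'
      b-not-kept : kept C τ b ≡ false
      b-not-kept = ≢true⇒false (λ k → true≢false (trans (sym (kept⊆C' b k)) (not-true⇒false (∧⁻ʳ {lookup C b} e'))))
      b∈B = proj₁ (not-kept C τ b cb b-not-kept)
      τ<ρ = proj₂ (not-kept C τ b cb b-not-kept)

ℕ→ℚ-as-mkℚ : ∀ m → ℕ→ℚ m ≡ Q.mkℚ (Z.+ m) 0 (CP.sym (CP.1-coprimeTo m))
ℕ→ℚ-as-mkℚ m = QP.normalize-coprime (CP.sym (CP.1-coprimeTo m))

ℕ→ℚ-as-ℚᵘ : ∀ m → Q.toℚᵘ (ℕ→ℚ m) U.≃ U.mkℚᵘ (Z.+ m) 0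
ℕ→ℚ-as-ℚᵘ m = QP.toℚᵘ-cong (ℕ→ℚ-as-mkℚ m)

*1 : ∀ a → Z.+ a Z.* Z.+ 1 ≡ Z.+ a
*1 a = ZP.*-identityʳ (Z.+ a)

ℕ→ℚ-mono-≤ : ∀ {a b} → a ≤ b → ℕ→ℚ a Q.≤ ℕ→ℚ b
ℕ→ℚ-mono-≤ {a} {b} le = subst₂ Q._≤_ (sym (ℕ→ℚ-as-mkℚ a)) (sym (ℕ→ℚ-as-mkℚ b)) (Q.*≤* (subst₂ Z._≤_ (sym (*1 a)) (sym (*1 b)) (Z.+≤+ le)))

ℕ→ℚ-mono-< : ∀ {a b} → a <ₙ b → ℕ→ℚ a < ℕ→ℚ b
ℕ→ℚ-mono-< {a} {b} lt = subst₂ _<_ (sym (ℕ→ℚ-as-mkℚ a)) (sym (ℕ→ℚ-as-mkℚ b)) (Q.*<* (subst₂ Z._<_ (sym (*1 a)) (sym (*1 b)) (Z.+<+ lt)))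

ℕ→ℚ-* : ∀ a b → ℕ→ℚ (a * b) ≡ ℕ→ℚ a Q.* ℕ→ℚ b
ℕ→ℚ-* a b = QP.toℚᵘ-injective (UP.≃-trans (ℕ→ℚ-as-ℚᵘ (a * b)) (UP.≃-trans as-ℚᵘ
              (UP.≃-sym (UP.≃-trans (QP.toℚᵘ-homo-* (ℕ→ℚ a) (ℕ→ℚ b)) (UP.*-cong (ℕ→ℚ-as-ℚᵘ a) (ℕ→ℚ-as-ℚᵘ b))))))
  where
  as-ℚᵘ : U.mkℚᵘ (Z.+ (a * b)) 0 U.≃ (U.mkℚᵘ (Z.+ a) 0 U.* U.mkℚᵘ (Z.+ b) 0)
  as-ℚᵘ = U.*≡* (cong (Z._* Z.+ 1) (ZP.pos-* a b))

ℕ→ℚ-+ : ∀ a b → ℕ→ℚ (a + b) ≡ ℕ→ℚ a Q.+ ℕ→ℚ b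
ℕ→ℚ-+ a b = QP.toℚᵘ-injective (UP.≃-trans (ℕ→ℚ-as-ℚᵘ (a + b)) (UP.≃-trans as-ℚᵘ
              (UP.≃-sym (UP.≃-trans (QP.toℚᵘ-homo-+ (ℕ→ℚ a) (ℕ→ℚ b)) (UP.+-cong (ℕ→ℚ-as-ℚᵘ a) (ℕ→ℚ-as-ℚᵘ b))))))
  where
  as-ℚᵘ : U.mkℚᵘ (Z.+ (a + b)) 0 U.≃ (U.mkℚᵘ (Z.+ a) 0 U.+ U.mkℚᵘ (Z.+ b) 0)
  as-ℚᵘ = U.*≡* (cong (Z._* Z.+ 1) (trans (ZP.pos-+ a b) (sym (cong₂ Z._+_ (*1 a) (*1 b)))))

ℕ→ℚ-nonNeg : ∀ q → Q.NonNegative (ℕ→ℚ q)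
ℕ→ℚ-nonNeg q = Q.nonNegative (ℕ→ℚ-mono-≤ {0} {q} z≤n)

ℕ→ℚ-pos : ∀ q → Q.Positive (ℕ→ℚ (suc q))
ℕ→ℚ-pos q = Q.positive (ℕ→ℚ-mono-< {0} {suc q} (s≤s z≤n))

integer-part : (ε : ℚ) (n : ℕ) → 0ℚ < ε → ε < 1ℚ → Σ ℕ λ M → (ℕ→ℚ M Q.≤ ε Q.* ℕ→ℚ n) × (ε Q.* ℕ→ℚ n < ℕ→ℚ (suc M))
integer-part ε n ε>0 ε<1 = scan (suc n) 0 εn≥0 εn<n+1
  where
  instance
    ε≥0 : Q.NonNegative ε
    ε≥0 = QP.pos⇒nonNeg ε {{Q.positive ε>0}}
    n≥0 : Q.NonNegative (ℕ→ℚ n)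
    n≥0 = ℕ→ℚ-nonNeg n
  x : ℚ
  x = ε Q.* ℕ→ℚ n
  εn≥0 : ℕ→ℚ 0 Q.≤ x
  εn≥0 = QP.nonNegative⁻¹ x {{QP.nonNeg*nonNeg⇒nonNeg ε (ℕ→ℚ n)}}
  εn<n+1 : x < ℕ→ℚ (0 + suc n)
  εn<n+1 = QP.≤-<-trans (QP.≤-trans (QP.*-monoʳ-≤-nonNeg (ℕ→ℚ n) (QP.<⇒≤ ε<1)) (QP.≤-reflexive (QP.*-identityˡ (ℕ→ℚ n))))
                        (ℕ→ℚ-mono-< {n} {suc n} ≤-refl)
  -- Invariant: j ≤ x < j + f.
  scan : (f j : ℕ) → ℕ→ℚ j Q.≤ x → x < ℕ→ℚ (j + f) → Σ ℕ λ M → (ℕ→ℚ M Q.≤ x) × (x < ℕ→ℚ (suc M))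
  scan zero j le lt = ⊥-elim (QP.<-irrefl refl (QP.≤-<-trans le (subst (λ z → x < ℕ→ℚ z) (+-identityʳ j) lt)))
  scan (suc f) j le lt with ℕ→ℚ (suc j) QP.≤? x
  ... | yes le' = scan f (suc j) le' (subst (λ z → x < ℕ→ℚ z) (+-suc j f) lt)
  ... | no nle = j , le , QP.≰⇒> nle

module EpsilonBounds (ε : ℚ) (ε>0 : 0ℚ < ε) (ε<1 : ε < 1ℚ) (n M : ℕ)
                     (M≤εn : ℕ→ℚ M Q.≤ ε Q.* ℕ→ℚ n) (εn<M+1 : ε Q.* ℕ→ℚ n < ℕ→ℚ (suc M)) where
  instance
    ε≥0 : Q.NonNegative ε
    ε≥0 = QP.pos⇒nonNeg ε {{Q.positive ε>0}}

  ≤M⇒≤εn : ∀ c → c ≤ M → ℕ→ℚ c Q.≤ ε Q.* ℕ→ℚ n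
  ≤M⇒≤εn c le = QP.≤-trans (ℕ→ℚ-mono-≤ le) M≤εn

  ≤nM⇒≤εn² : ∀ E → E ≤ n * M → ℕ→ℚ E Q.≤ ε Q.* ℕ→ℚ (n * n)
  ≤nM⇒≤εn² E le = begin
      ℕ→ℚ E                        ≤⟨ ℕ→ℚ-mono-≤ le ⟩
      ℕ→ℚ (n * M)                  ≡⟨ ℕ→ℚ-* n M ⟩
      ℕ→ℚ n Q.* ℕ→ℚ M              ≤⟨ QP.*-monoˡ-≤-nonNeg (ℕ→ℚ n) {{ℕ→ℚ-nonNeg n}} M≤εn ⟩
      ℕ→ℚ n Q.* (ε Q.* ℕ→ℚ n)      ≡⟨ QP.*-assoc (ℕ→ℚ n) ε (ℕ→ℚ n) ⟨
      (ℕ→ℚ n Q.* ε) Q.* ℕ→ℚ n      ≡⟨ cong (Q._* ℕ→ℚ n) (QP.*-comm (ℕ→ℚ n) ε) ⟩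
      (ε Q.* ℕ→ℚ n) Q.* ℕ→ℚ n      ≡⟨ QP.*-assoc ε (ℕ→ℚ n) (ℕ→ℚ n) ⟩
      ε Q.* (ℕ→ℚ n Q.* ℕ→ℚ n)      ≡⟨ cong (ε Q.*_) (ℕ→ℚ-* n n) ⟨
      ε Q.* ℕ→ℚ (n * n)            ∎
    where open QP.≤-Reasoning

  -- q = ⌊(n-1)/(M+1)⌋ satisfies q(M+1) ≤ n < (M+1)/ε, hence qε ≤ 1.
  q : ℕ
  q = (n ∸ 1) / suc M

  qε≤1 : ℕ→ℚ q Q.* ε Q.≤ 1ℚ
  qε≤1 = by-cases n refl
    where
    by-cases : ∀ k → k ≡ n → ℕ→ℚ q Q.* ε Q.≤ 1ℚ
    by-cases zero refl = subst (Q._≤ 1ℚ) (sym (QP.*-zeroˡ ε)) (Q.*≤* (Z.+≤+ z≤n))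
    by-cases (suc n') refl = QP.*-cancelʳ-≤-pos (ℕ→ℚ n) {{ℕ→ℚ-pos n'}} (begin
        (ℕ→ℚ q Q.* ε) Q.* ℕ→ℚ n      ≡⟨ QP.*-assoc (ℕ→ℚ q) ε (ℕ→ℚ n) ⟩
        ℕ→ℚ q Q.* (ε Q.* ℕ→ℚ n)      ≤⟨ QP.*-monoˡ-≤-nonNeg (ℕ→ℚ q) {{ℕ→ℚ-nonNeg q}} (QP.<⇒≤ εn<M+1) ⟩
        ℕ→ℚ q Q.* ℕ→ℚ (suc M)        ≡⟨ ℕ→ℚ-* q (suc M) ⟨
        ℕ→ℚ (q * suc M)              ≤⟨ ℕ→ℚ-mono-≤ (≤-trans (m/n*n≤m (n ∸ 1) (suc M)) (m∸n≤m n 1)) ⟩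
        ℕ→ℚ n                        ≡⟨ QP.*-identityˡ (ℕ→ℚ n) ⟨
        1ℚ Q.* ℕ→ℚ n                 ∎)
      where open QP.≤-Reasoning

  length-bound : ∀ k → k ≤ suc q → ℕ→ℚ k Q.* ε Q.≤ ℕ→ℚ 2
  length-bound k le = begin
      ℕ→ℚ k Q.* ε                    ≤⟨ QP.*-monoʳ-≤-nonNeg ε (ℕ→ℚ-mono-≤ (subst (k ≤_) (+-comm 1 q) le)) ⟩
      ℕ→ℚ (q + 1) Q.* ε              ≡⟨ cong (Q._* ε) (ℕ→ℚ-+ q 1) ⟩
      (ℕ→ℚ q Q.+ 1ℚ) Q.* ε           ≡⟨ QP.*-distribʳ-+ ε (ℕ→ℚ q) 1ℚ ⟩
      ℕ→ℚ q Q.* ε Q.+ 1ℚ Q.* ε       ≡⟨ cong (ℕ→ℚ q Q.* ε Q.+_) (QP.*-identityˡ ε) ⟩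
      ℕ→ℚ q Q.* ε Q.+ ε              ≤⟨ QP.+-mono-≤ qε≤1 (QP.<⇒≤ ε<1) ⟩
      1ℚ Q.+ 1ℚ                      ≡⟨⟩
      ℕ→ℚ 2                          ∎
    where open QP.≤-Reasoning

lemma7p13 : (n : ℕ) (G : Graph n) → Chordal G →
    (C₁ C₂ : Subset n) → IsMaximalClique G C₁ → IsMaximalClique G C₂ →
    (ε : ℚ) → 0ℚ < ε → ε < 1ℚ →
    Σ (Graph n) λ G' → IsSimplification G C₁ C₂ ε G'
lemma7p13 n G chordal C₁ C₂ max₁ max₂ ε ε>0 ε<1 = simplification (integer-part ε n ε>0 ε<1)
  where
  simplification : (Σ ℕ λ M → (ℕ→ℚ M Q.≤ ε Q.* ℕ→ℚ n) × (ε Q.* ℕ→ℚ n < ℕ→ℚ (suc M))) → Σ (Graph n) λ G' → IsSimplification G C₁ C₂ ε G'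
  simplification (M , M≤εn , εn<M+1) =
    G' , deletes , ≤nM⇒≤εn² (edgeDiff G G') edgeDiff-bound , chordal' ,
    (len , path , (path-injective , path-maximal , path-covers , path-interval) , length-bound len len-bound , path-first , path-last) ,
    condition3ε
    where
    open Simplification G chordal C₁ C₂ max₁ max₂ M
    open EpsilonBounds ε ε>0 ε<1 n M M≤εn εn<M+1
    condition3ε : ∀ C → IsClique G C → C ⊆ (C₁ ∪ C₂) → Σ (Subset n) λ C' → IsMaximalClique G' C' × (ℕ→ℚ ∣ C ─ C' ∣ Q.≤ ε Q.* ℕ→ℚ n)
    condition3ε C clC C⊆S with condition3 C clC C⊆S
    ... | C' , maxC' , lost≤M = C' , maxC' , ≤M⇒≤εn _ lost≤M
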